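{- Let $\mathbf{g}\in E$ and $\tau\in\mathcal{U}_{\mathbf{g},\mathbf{g}}$. Then $C_\tau C_\tau=\overline{k_\tau}\,C_\tau$. In particular, the center $\mathrm{Z}(\mathbb{T})$ is a semisimple $\mathbb{F}$-algebra only if $p\nmid k_\sigma$ for every $\mathbf{i}\in E$ and every $\sigma\in\mathcal{U}_{\mathbf{i},\mathbf{i}}$.
   Context: Let $\mathbb{F}$ be a field of characteristic $p$ ($p=0$ or a prime). For an integer $a$ let $\overline{a}$ be its image in $\mathbb{F}$; write $p\mid a$ if $\overline a=0$ and $p\nmid a$ otherwise. Fix $n\ge1$ and integers $\ell_1,\dots,\ell_n,m_1,\dots,m_n\ge2$. For each $i\in\{1,\dots,n\}$ let $U_i$ be a set with $|U_i|=\ell_im_i$ partitioned into $\ell_i$ blocks of size $m_i$, with relations $R^i_0=\{(a,a)\}$, $R^i_1=\{(a,b):a\ne b\text{ in the same block}\}$, $R^i_2=\{(a,b):a,b\text{ in different blocks}\}$. Let $X=\prod_iU_i$, $E$ the set of $n$-tuples with entries in $\{0,1,2\}$, $R_{\mathbf{g}}=\{(\mathbf{a},\mathbf{b}):(\mathbf{a}_i,\mathbf{b}_i)\in R^i_{\mathbf{g}_i}\ \forall i\}$. For $\mathbf{g}\in E$, $j\in\{0,1,2\}$ put $S_j(\mathbf{g})=\{a:\mathbf{g}_a=j\}$; for $V\subseteq\{1,\dots,n\}$ put $V^\bullet=\{a\in V:\ell_a>2\}$, $V^\circ=\{a\in V:m_a>2\}$. Fix $\mathbf{x}\in X$; $A_{\mathbf{g}}\in\mathrm{M}_X(\mathbb{F})$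 is the $0/1$ adjacency matrix of $R_{\mathbf{g}}$, $E^*_{\mathbf{g}}$ the diagonal matrix with $(\mathbf{y},\mathbf{y})$-entry $\overline1$ iff $(\mathbf{x},\mathbf{y})\in R_{\mathbf{g}}$, $\mathbb{T}$ the $\mathbb{F}$-subalgebra of $\mathrm{M}_X(\mathbb{F})$ generated by all $A_{\mathbf{g}},E^*_{\mathbf{g}}$; $O$ is the zero matrix. For a triple $\tau=(J_1,J_2,J_3)$ of subsets and $\mathbf{g}\in E$: $\tau\setminus\mathbf{g}=(J_1\setminus S_1(\mathbf{g}),J_2\setminus S_2(\mathbf{g}),J_3\setminus S_2(\mathbf{g}))$, $\mathbf{g}\cap\tau=(S_1(\mathbf{g})\cap J_1,S_2(\mathbf{g})\cap J_2,S_2(\mathbf{g})\cap J_3)$, $k_\tau=\prod_{j\in J_1}(m_j-1)\prod_{j\in J_2}(\ell_j-1)m_j\prod_{j\in J_3\setminus J_2}m_j$ (empty products $=1$). For $\mathbf{g},\mathbf{h}\in E$, $\mathcal{U}_{\mathbf{g},\mathbf{h}}$ is the set of triples $(J_1,J_2,J_3)$ with $J_1\subseteq(S_1(\mathbf{g})\cap S_1(\mathbf{h}))^\circ$, $J_2\subseteq(S_2(\mathbf{g})\cap S_2(\mathbf{h}))^\bullet$, $J_2\subseteq J_3\subseteq S_2(\mathbf{g})\cap S_2(\mathbf{h})$. For $\tau=(J_1,J_2,J_3)\in\mathcal{U}_{\mathbf{g},\mathbf{h}}$, $B_{\mathbf{g},\mathbf{h},\tau}=\sum E^*_{\mathbf{g}}A_{\mathbf{a}}E^*_{\mathbf{h}}$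 over all $\mathbf{a}\in E$ with $E^*_{\mathbf{g}}A_{\mathbf{a}}E^*_{\mathbf{h}}\ne O$, $S_1(\mathbf{a})\cap(S_1(\mathbf{g})\cap S_1(\mathbf{h}))^\circ\subseteq J_1$, $S_2(\mathbf{a})\cap(S_2(\mathbf{g})\cap S_2(\mathbf{h}))^\bullet\subseteq J_2$, $S_1(\mathbf{a})\cap S_2(\mathbf{g})\cap S_2(\mathbf{h})\subseteq J_3$. For $\tau\in\mathcal{U}_{\mathbf{g},\mathbf{g}}$, $C_\tau=\sum_{\mathbf{i}\in E}\overline{k_{\tau\setminus\mathbf{i}}}\,B_{\mathbf{i},\mathbf{i},\mathbf{i}\cap\tau}$. -}

module Defs where

open import Level using (Level; _⊔_) renaming (suc to lsuc)
open import Algebra.Bundles using (CommutativeRing)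
open import Data.Nat as ℕ using (ℕ; zero; suc; _∸_; _<ᵇ_)
open import Data.Fin as Fin using (Fin; zero; suc)
open import Data.Bool using (Bool; true; false; _∧_; _∨_; not; if_then_else_; T)
open import Data.List using (List; []; _∷_; map; concatMap; foldr; allFin; filterᵇ; cartesianProduct)
open import Data.Bool.ListAction using (all; any)
open import Data.Product using (_×_; _,_; proj₁; proj₂; ∃)
open import Relation.Nullary using (¬_; ⌊_⌋)

record Field (c ℓ : Level) : Set (lsuc (c ⊔ ℓ)) where
  field
    commutativeRing : CommutativeRing c ℓ
  open CommutativeRing commutativeRing public
  field
    1≉0     : ¬ (1# ≈ 0#)
    inverse : ∀ x → ¬ (x ≈ 0#) → ∃ λ y → x * y ≈ 1#

consF : ∀ {a} {n} {A : Fin (suc n) → Set a} →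
        A zero → ((i : Fin n) → A (suc i)) → (i : Fin (suc n)) → A i
consF a f zero    = a
consF a f (suc i) = f i

allFuns : ∀ {a} (n : ℕ) (A : Fin n → Set a) → ((i : Fin n) → List (A i)) →
          List ((i : Fin n) → A i)
allFuns zero    A enum = (λ ()) ∷ []
allFuns (suc n) A enum =
  concatMap (λ a → map (consF {A = A} a) (allFuns n (λ i → A (suc i)) (λ i → enum (suc i))))
            (enum zero)

module Scheme (n : ℕ) (ℓs ms : Fin n → ℕ) where

  -- U_i : ℓ_i blocks of size m_i; an element is (block, position in block)
  U : Fin n → Set
  U i = Fin (ℓs i) × Fin (ms i)

  X : Set
  X = (i : Fin n) → U i

  allX : List X
  allX = allFuns n U (λ i → cartesianProduct (allFin (ℓs i)) (allFin (ms i)))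

  E : Set
  E = Fin n → Fin 3

  allE : List E
  allE = allFuns n (λ _ → Fin 3) (λ _ → allFin 3)

  eqE : E → E → Bool
  eqE g h = all (λ i → ⌊ g i Fin.≟ h i ⌋) (allFin n)

  eqX : X → X → Bool
  eqX a b = all (λ i → ⌊ proj₁ (a i) Fin.≟ proj₁ (b i) ⌋ ∧ ⌊ proj₂ (a i) Fin.≟ proj₂ (b i) ⌋) (allFin n)

  -- (a,b) ∈ R^i_j  iff  relU a b = j
  relU : ∀ {i} → U i → U i → Fin 3
  relU (bl₁ , p₁) (bl₂ , p₂) =
    if ⌊ bl₁ Fin.≟ bl₂ ⌋
    then (if ⌊ p₁ Fin.≟ p₂ ⌋ then Fin.zero else Fin.suc Fin.zero)
    else Fin.suc (Fin.suc Fin.zero)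

  -- (a,b) ∈ R_g  iff  eqE (rel a b) g = true
  rel : X → X → E
  rel a b i = relU (a i) (b i)

  Sub : Set
  Sub = Fin n → Bool

  _∩_ : Sub → Sub → Sub
  (V ∩ W) a = V a ∧ W a

  _⊆_ : Sub → Sub → Set
  V ⊆ W = ∀ a → T (V a) → T (W a)

  _⊆ᵇ_ : Sub → Sub → Bool
  V ⊆ᵇ W = all (λ a → not (V a) ∨ W a) (allFin n)

  S : Fin 3 → E → Sub
  S j g a = ⌊ g a Fin.≟ j ⌋

  S₁ S₂ : E → Sub
  S₁ = S (Fin.suc Fin.zero)
  S₂ = S (Fin.suc (Fin.suc Fin.zero))

  _• : Sub → Sub
  (V •) a = V a ∧ (2 <ᵇ ℓs a)

  _∘ : Sub → Sub
  (V ∘) a = V a ∧ (2 <ᵇ ms a)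

  record Triple : Set where
    constructor ⟨_,_,_⟩
    field
      J₁ J₂ J₃ : Sub
  open Triple public

  _∖_ : Triple → E → Triple
  ⟨ J₁ , J₂ , J₃ ⟩ ∖ g = ⟨ (λ a → J₁ a ∧ not (S₁ g a)) , (λ a → J₂ a ∧ not (S₂ g a)) , (λ a → J₃ a ∧ not (S₂ g a)) ⟩

  _⋂_ : E → Triple → Triple
  g ⋂ ⟨ J₁ , J₂ , J₃ ⟩ = ⟨ S₁ g ∩ J₁ , S₂ g ∩ J₂ , S₂ g ∩ J₃ ⟩

  prodℕ : (Fin n → ℕ) → ℕ
  prodℕ f = foldr (λ a r → f a ℕ.* r) 1 (allFin n)

  k : Triple → ℕ
  k ⟨ J₁ , J₂ , J₃ ⟩ =
    prodℕ (λ j → if J₁ j then ms j ∸ 1 else 1) ℕ.*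
    (prodℕ (λ j → if J₂ j then (ℓs j ∸ 1) ℕ.* ms j else 1) ℕ.*
     prodℕ (λ j → if J₃ j ∧ not (J₂ j) then ms j else 1))

  record _∈𝒰[_,_] (τ : Triple) (g h : E) : Set where
    field
      J₁⊆ : J₁ τ ⊆ ((S₁ g ∩ S₁ h) ∘)
      J₂⊆ : J₂ τ ⊆ ((S₂ g ∩ S₂ h) •)
      J₂⊆J₃ : J₂ τ ⊆ J₃ τ
      J₃⊆ : J₃ τ ⊆ (S₂ g ∩ S₂ h)

-- Matrices over a field, indexed by X, with the base vertex x fixed

module Algebras {c ℓ} (F : Field c ℓ) (n : ℕ) (ℓs ms : Fin n → ℕ) (x : Scheme.X n ℓs ms) where
  open Scheme n ℓs ms
  open Field F using (Carrier; _≈_; _+_; _*_; 0#; 1#)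

  Mat : Set c
  Mat = X → X → Carrier

  _≈ᴹ_ : Mat → Mat → Set ℓ
  M ≈ᴹ N = ∀ a b → M a b ≈ N a b

  Σ[_]_ : ∀ {a} {A : Set a} → List A → (A → Carrier) → Carrier
  Σ[ xs ] f = foldr (λ a r → f a + r) 0# xs

  O : Mat
  O a b = 0#

  I : Mat
  I a b = if eqX a b then 1# else 0#

  _⊕_ : Mat → Mat → Mat
  (M ⊕ N) a b = M a b + N a b

  _·_ : Carrier → Mat → Mat
  (s · M) a b = s * M a b

  _⊗_ : Mat → Mat → Mat
  (M ⊗ N) a b = Σ[ allX ] (λ z → M a z * N z b)

  ΣM : ∀ {a} {A : Set a} → List A → (A → Mat) → Mat
  ΣM xs f = foldr (λ a r → f a ⊕ r) O xs

  ι : ℕ → Carrier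
  ι zero    = 0#
  ι (suc k) = 1# + ι k

  A : E → Mat
  A g a b = if eqE (rel a b) g then 1# else 0#

  E* : E → Mat
  E* g a b = if eqE (rel x a) g ∧ eqX a b then 1# else 0#

  -- E*_g A_a E*_h ≠ O  (its entries are 0/1 and 1 ≠ 0 in 𝔽, so this holds
  -- iff some entry is 1, i.e. iff some (y,z) has (x,y)∈R_g,(y,z)∈R_a,(x,z)∈R_h)
  nonzeroᵇ : E → E → E → Bool
  nonzeroᵇ g a h = any (λ y → any (λ z → eqE (rel x y) g ∧ (eqE (rel y z) a ∧ eqE (rel x z) h)) allX) allX

  B : E → E → Triple → Mat
  B g h ⟨ J₁ , J₂ , J₃ ⟩ =
    ΣM (filterᵇ cond allE) (λ a → (E* g ⊗ A a) ⊗ E* h)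
    where
      cond : E → Bool
      cond a = nonzeroᵇ g a h
             ∧ (((S₁ a ∩ ((S₁ g ∩ S₁ h) ∘)) ⊆ᵇ J₁)
             ∧ (((S₂ a ∩ ((S₂ g ∩ S₂ h) •)) ⊆ᵇ J₂)
             ∧ ((S₁ a ∩ (S₂ g ∩ S₂ h)) ⊆ᵇ J₃)))

  C : Triple → Mat
  C τ = ΣM allE (λ i → ι (k (τ ∖ i)) · B i i (i ⋂ τ))

  data InT : Mat → Set (c ⊔ ℓ) where
    genA  : ∀ g → InT (A g)
    genE  : ∀ g → InT (E* g)
    one   : InT I
    zer   : InT O
    add   : ∀ {M N} → InT M → InT N → InT (M ⊕ N)
    scale : ∀ s {M} → InT M → InT (s · M)
    mul   : ∀ {M N} → InT M → InT N → InT (M ⊗ N)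
    resp  : ∀ {M N} → M ≈ᴹ N → InT M → InT N

  InZ : Mat → Set (c ⊔ ℓ)
  InZ M = InT M × (∀ N → InT N → (M ⊗ N) ≈ᴹ (N ⊗ M))

  prodM : ∀ {r} → (Fin r → Mat) → Mat
  prodM {zero}  f = I
  prodM {suc r} f = f zero ⊗ prodM (λ j → f (suc j))

  record IsNilpotentIdealOfZ (𝓘 : Mat → Set (c ⊔ ℓ)) : Set (c ⊔ ℓ) where
    field
      ⊆Z     : ∀ {M} → 𝓘 M → InZ M
      resp𝓘  : ∀ {M N} → M ≈ᴹ N → 𝓘 M → 𝓘 N
      zero𝓘  : 𝓘 O
      add𝓘   : ∀ {M N} → 𝓘 M → 𝓘 N → 𝓘 (M ⊕ N)
      scale𝓘 : ∀ s {M} → 𝓘 M → 𝓘 (s · M)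
      mulˡ   : ∀ {M N} → InZ N → 𝓘 M → 𝓘 (N ⊗ M)
      mulʳ   : ∀ {M N} → InZ N → 𝓘 M → 𝓘 (M ⊗ N)
      nilpotent : ∃ λ r → ∀ (f : Fin r → Mat) → (∀ j → 𝓘 (f j)) → prodM f ≈ᴹ O

  -- Z(𝕋) is semisimple: its Jacobson radical (= the largest nilpotent ideal,
  -- as Z(𝕋) is finite-dimensional) is zero, i.e. every nilpotent ideal is 0.
  ZSemisimple : Set (lsuc (c ⊔ ℓ))
  ZSemisimple = ∀ 𝓘 → IsNilpotentIdealOfZ 𝓘 → ∀ {M} → 𝓘 M → M ≈ᴹ O

module Submission where

open import Defs
open import Level using (Level)
open import Data.Nat using (ℕ; _≤_)
open import Data.Fin using (Fin)
open import Data.Product using (_×_)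
open import Relation.Nullary using (¬_)

open import Level using (_⊔_)
open import Algebra.Bundles using (CommutativeSemiring; CommutativeRing)
open import Relation.Binary.Bundles using (Setoid)
open import Data.Nat as ℕ using (zero; suc; _<ᵇ_)
import Data.Nat.Properties as ℕ
open import Data.Fin as Fin using (zero; suc)
open import Data.Fin.Patterns using (0F; 1F; 2F)
open import Data.Bool using (Bool; true; false; _∧_; _∨_; not; if_then_else_; T)
open import Data.Bool.Properties using (T-∧; not-involutive; ∧-comm)
open import Data.Bool.ListAction using (all; and)
open import Data.List using (List; []; _∷_; _++_; map; concat; concatMap; foldr; filterᵇ; tabulate; allFin; cartesianProduct)
open import Data.List.Properties using (map-cong)
open import Data.List.Relation.Unary.Any using (Any; here)
import Data.List.Relation.Unary.Any as Any using (map)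
import Data.List.Relation.Unary.Any.Properties as Any
open import Data.List.Membership.Propositional using (_∈_)
open import Data.List.Membership.Propositional.Properties using (∈-cartesianProduct⁺; ∈-allFin)
open import Data.Product using (_,_; proj₁; proj₂; ∃-syntax)
open import Data.Empty using (⊥-elim)
open import Data.Unit using (tt)
open import Function using (_∘_; id)
open import Function.Bundles using (Equivalence)
open import Relation.Nullary using (⌊_⌋; yes; no; Dec)
open import Relation.Nullary.Decidable using (isYes≗does; dec-true; dec-false)
open import Relation.Binary.PropositionalEquality as ≡ using (_≡_)

-- X is the product of the Uⱼ, and everything factors over the coordinates: the (y, z) entry of
-- I, A_g, E*_g and E*_i A_a E*_i is a product over j of 0/1 values depending only on (y_j, z_j),
-- and the sums over a ∈ E in B and over i ∈ E in C_τ commute with these products.  So C_τ is the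
-- tensor product of natural-number matrices Cᶜⱼ on the Uⱼ, and k_τ = ∏ⱼ kⱼ.  For τ ∈ 𝒰_{g,g} each
-- coordinate is of one of four kinds (j ∉ J₁ ∪ J₃, j ∈ J₁, j ∈ J₃ ∖ J₂, j ∈ J₂), and in each Cᶜⱼ
-- is kⱼ times the identity off one relation class S of xⱼ, while on S it is the indicator of an
-- equivalence relation all of whose classes have kⱼ elements.  Hence Cᶜⱼ² = kⱼ Cᶜⱼ, and Cᶜⱼ
-- commutes with the coordinate factors of I, A_h and E*_h; multiplying out, C_τ² = k_τ C_τ and C_τ
-- is central in 𝕋.  Finally C_σ has a diagonal entry 1; if k_σ = 0 in 𝔽 then C_σ² = 0, and the
-- multiples of C_σ in Z(𝕋) form a nonzero nilpotent ideal, which semisimplicity forbids.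

⌊≟⌋-refl : ∀ {m} (a : Fin m) → ⌊ a Fin.≟ a ⌋ ≡ true
⌊≟⌋-refl a = ≡.trans (isYes≗does (a Fin.≟ a)) (dec-true (a Fin.≟ a) ≡.refl)

⌊≟⌋-≢ : ∀ {m} {a b : Fin m} → ¬ a ≡ b → ⌊ a Fin.≟ b ⌋ ≡ false
⌊≟⌋-≢ {a = a} {b} a≢b = ≡.trans (isYes≗does (a Fin.≟ b)) (dec-false (a Fin.≟ b) a≢b)

⌊≟⌋-sym : ∀ {m} (a b : Fin m) → ⌊ a Fin.≟ b ⌋ ≡ ⌊ b Fin.≟ a ⌋
⌊≟⌋-sym a b with a Fin.≟ b
... | yes ≡.refl = ≡.sym (⌊≟⌋-refl a)
... | no a≢b     = ≡.sym (⌊≟⌋-≢ (a≢b ∘ ≡.sym))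

⌊suc≟suc⌋ : ∀ {m} (a b : Fin m) → ⌊ suc a Fin.≟ suc b ⌋ ≡ ⌊ a Fin.≟ b ⌋
⌊suc≟suc⌋ a b = ≡.trans (isYes≗does (suc a Fin.≟ suc b)) (≡.sym (isYes≗does (a Fin.≟ b)))

module ListSum {c ℓ} (R : CommutativeSemiring c ℓ) where
  open CommutativeSemiring R hiding (zero)
  open import Algebra.Properties.Semiring.Sum semiring public using (sum; sum-cong-≋; *-distribˡ-sum; *-distribʳ-sum)
  open import Algebra.Properties.Semiring.Sum semiring using (sum-replicate-zero)
  open import Algebra.Properties.CommutativeMonoid.Sum *-commutativeMonoid public
    using () renaming (sum to ∏; sum-cong-≋ to ∏-cong; ∑-distrib-+ to ∏-distrib-*; sum-replicate-zero to ∏-replicate-1#)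
  open import Algebra.Properties.CommutativeSemigroup +-commutativeSemigroup using () renaming (x∙yz≈y∙xz to x+[y+z]≈y+[x+z])
  open import Relation.Binary.Reasoning.Setoid setoid

  private
    variable
      a b : Level
      A : Set a
      B : Set b

  -- Σ[_]_ and ΣM of Defs are these list sums.
  ∑ₗ : List A → (A → Carrier) → Carrier
  ∑ₗ xs f = foldr (λ a r → f a + r) 0# xs

  [_] : Bool → Carrier
  [ b ] = if b then 1# else 0#

  ∑ₗ-cong : (xs : List A) {f g : A → Carrier} → (∀ a → f a ≈ g a) → ∑ₗ xs f ≈ ∑ₗ xs g
  ∑ₗ-cong []       f≈g = refl
  ∑ₗ-cong (x ∷ xs) f≈g = +-cong (f≈g x) (∑ₗ-cong xs f≈g)

  ∑ₗ-zero : (xs : List A) → ∑ₗ xs (λ _ → 0#) ≈ 0#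
  ∑ₗ-zero []       = refl
  ∑ₗ-zero (x ∷ xs) = trans (+-identityˡ _) (∑ₗ-zero xs)

  ∑ₗ-distrib-+ : (xs : List A) (f g : A → Carrier) → ∑ₗ xs (λ a → f a + g a) ≈ ∑ₗ xs f + ∑ₗ xs g
  ∑ₗ-distrib-+ []       f g = sym (+-identityˡ 0#)
  ∑ₗ-distrib-+ (x ∷ xs) f g = begin
    (f x + g x) + ∑ₗ xs (λ a → f a + g a) ≈⟨ +-congˡ (∑ₗ-distrib-+ xs f g) ⟩
    (f x + g x) + (∑ₗ xs f + ∑ₗ xs g)     ≈⟨ +-assoc (f x) (g x) _ ⟩
    f x + (g x + (∑ₗ xs f + ∑ₗ xs g))     ≈⟨ +-congˡ (x+[y+z]≈y+[x+z] (g x) (∑ₗ xs f) (∑ₗ xs g)) ⟩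
    f x + (∑ₗ xs f + (g x + ∑ₗ xs g))     ≈⟨ +-assoc (f x) _ _ ⟨
    (f x + ∑ₗ xs f) + (g x + ∑ₗ xs g)     ∎

  *-distribˡ-∑ₗ : (xs : List A) (k : Carrier) (f : A → Carrier) → k * ∑ₗ xs f ≈ ∑ₗ xs (λ a → k * f a)
  *-distribˡ-∑ₗ []       k f = zeroʳ k
  *-distribˡ-∑ₗ (x ∷ xs) k f = trans (distribˡ k (f x) _) (+-congˡ (*-distribˡ-∑ₗ xs k f))

  *-distribʳ-∑ₗ : (xs : List A) (k : Carrier) (f : A → Carrier) → ∑ₗ xs f * k ≈ ∑ₗ xs (λ a → f a * k)
  *-distribʳ-∑ₗ xs k f = trans (*-comm _ k) (trans (*-distribˡ-∑ₗ xs k f) (∑ₗ-cong xs (λ a → *-comm k (f a))))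

  ∑ₗ-++ : (xs ys : List A) (f : A → Carrier) → ∑ₗ (xs ++ ys) f ≈ ∑ₗ xs f + ∑ₗ ys f
  ∑ₗ-++ []       ys f = sym (+-identityˡ _)
  ∑ₗ-++ (x ∷ xs) ys f = trans (+-congˡ (∑ₗ-++ xs ys f)) (sym (+-assoc (f x) _ _))

  ∑ₗ-map : (g : A → B) (xs : List A) (f : B → Carrier) → ∑ₗ (map g xs) f ≡ ∑ₗ xs (f ∘ g)
  ∑ₗ-map g []       f = ≡.refl
  ∑ₗ-map g (x ∷ xs) f = ≡.cong (f (g x) +_) (∑ₗ-map g xs f)

  ∑ₗ-concatMap : (g : A → List B) (xs : List A) (f : B → Carrier) →
                 ∑ₗ (concatMap g xs) f ≈ ∑ₗ xs (λ a → ∑ₗ (g a) f)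
  ∑ₗ-concatMap g []       f = refl
  ∑ₗ-concatMap g (x ∷ xs) f = trans (∑ₗ-++ (g x) (concat (map g xs)) f) (+-congˡ (∑ₗ-concatMap g xs f))

  ∑ₗ-comm : (xs : List A) (ys : List B) (f : A → B → Carrier) →
            ∑ₗ xs (λ a → ∑ₗ ys (f a)) ≈ ∑ₗ ys (λ b → ∑ₗ xs (λ a → f a b))
  ∑ₗ-comm []       ys f = sym (∑ₗ-zero ys)
  ∑ₗ-comm (x ∷ xs) ys f = trans (+-congˡ (∑ₗ-comm xs ys f)) (sym (∑ₗ-distrib-+ ys (f x) _))

  ∑ₗ-filterᵇ : (p : A → Bool) (xs : List A) (f : A → Carrier) → ∑ₗ (filterᵇ p xs) f ≈ ∑ₗ xs (λ a → [ p a ] * f a)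
  ∑ₗ-filterᵇ p []       f = refl
  ∑ₗ-filterᵇ p (x ∷ xs) f with p x
  ... | true  = +-cong (sym (*-identityˡ _)) (∑ₗ-filterᵇ p xs f)
  ... | false = trans (∑ₗ-filterᵇ p xs f) (trans (sym (+-identityˡ _)) (+-congʳ (sym (zeroˡ _))))

  ∑ₗ-tabulate : ∀ {n} (t : Fin n → A) (f : A → Carrier) → ∑ₗ (tabulate t) f ≡ sum (f ∘ t)
  ∑ₗ-tabulate {n = zero}  t f = ≡.refl
  ∑ₗ-tabulate {n = suc n} t f = ≡.cong (f (t zero) +_) (∑ₗ-tabulate (t ∘ suc) f)

  ∑ₗ-allFuns : ∀ n (A : Fin n → Set a) (enum : ∀ i → List (A i)) (f : ∀ i → A i → Carrier) →
               ∑ₗ (allFuns n A enum) (λ t → ∏ (λ i → f i (t i))) ≈ ∏ (λ i → ∑ₗ (enum i) (f i))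
  ∑ₗ-allFuns zero    A enum f = +-identityʳ 1#
  ∑ₗ-allFuns (suc n) A enum f = begin
    ∑ₗ (concatMap (λ a → map (consF {A = A} a) rest) (enum zero)) ∏f
      ≈⟨ ∑ₗ-concatMap (λ a → map (consF {A = A} a) rest) (enum zero) ∏f ⟩
    ∑ₗ (enum zero) (λ a → ∑ₗ (map (consF {A = A} a) rest) ∏f)
      ≈⟨ ∑ₗ-cong (enum zero) (λ a → reflexive (∑ₗ-map (consF {A = A} a) rest ∏f)) ⟩
    ∑ₗ (enum zero) (λ a → ∑ₗ rest (λ t → f zero a * ∏ (λ i → f (suc i) (t i))))
      ≈⟨ ∑ₗ-cong (enum zero) (λ a → sym (*-distribˡ-∑ₗ rest (f zero a) _)) ⟩
    ∑ₗ (enum zero) (λ a → f zero a * ∑ₗ rest (λ t → ∏ (λ i → f (suc i) (t i))))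
      ≈⟨ ∑ₗ-cong (enum zero) (λ a → *-congˡ (∑ₗ-allFuns n (A ∘ suc) (enum ∘ suc) (f ∘ suc))) ⟩
    ∑ₗ (enum zero) (λ a → f zero a * ∏ (λ i → ∑ₗ (enum (suc i)) (f (suc i))))
      ≈⟨ *-distribʳ-∑ₗ (enum zero) _ (f zero) ⟨
    ∑ₗ (enum zero) (f zero) * ∏ (λ i → ∑ₗ (enum (suc i)) (f (suc i))) ∎
    where
    rest : List ((i : Fin n) → A (suc i))
    rest = allFuns n (A ∘ suc) (enum ∘ suc)
    ∏f : ((i : Fin (suc n)) → A i) → Carrier
    ∏f t = ∏ (λ i → f i (t i))

  [∧] : ∀ b b′ → [ b ∧ b′ ] ≈ [ b ] * [ b′ ]
  [∧] true  b′ = sym (*-identityˡ _)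
  [∧] false b′ = sym (zeroˡ _)

  [b]*[b] : ∀ b → [ b ] * [ b ] ≈ [ b ]
  [b]*[b] true  = *-identityˡ 1#
  [b]*[b] false = zeroˡ 0#

  [all] : ∀ {n} (p : Fin n → Bool) → [ all p (allFin n) ] ≈ ∏ (λ i → [ p i ])
  [all] p = go id
    where
    go : ∀ {m} (t : Fin m → Fin _) → [ all p (tabulate t) ] ≈ ∏ (λ i → [ p (t i) ])
    go {zero}  t = refl
    go {suc m} t = trans ([∧] (p (t zero)) _) (*-congˡ (go (t ∘ suc)))

  ∏-tabulate : ∀ {n} (t : Fin n → A) (f : A → Carrier) → foldr (λ a r → f a * r) 1# (tabulate t) ≡ ∏ (f ∘ t)
  ∏-tabulate {n = zero}  t f = ≡.refl
  ∏-tabulate {n = suc n} t f = ≡.cong (f (t zero) *_) (∏-tabulate (t ∘ suc) f)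

  ∑-δ : ∀ {m} (a : Fin m) (f : Fin m → Carrier) → sum (λ p → [ ⌊ a Fin.≟ p ⌋ ] * f p) ≈ f a
  ∑-δ {suc m} zero f =
    trans (+-cong (*-identityˡ _) (trans (sum-cong-≋ (λ p → zeroˡ (f (suc p)))) (sum-replicate-zero m))) (+-identityʳ _)
  ∑-δ {suc m} (suc a) f = trans (+-cong (zeroˡ _) (trans (sum-cong-≋ δ-suc) (∑-δ a (f ∘ suc)))) (+-identityˡ _)
    where
    δ-suc : ∀ p → [ ⌊ suc a Fin.≟ suc p ⌋ ] * f (suc p) ≈ [ ⌊ a Fin.≟ p ⌋ ] * f (suc p)
    δ-suc p = *-congʳ (reflexive (≡.cong [_] (⌊suc≟suc⌋ a p)))

  ∑ₗ-δ : ∀ {m} (a : Fin m) (f : Fin m → Carrier) → ∑ₗ (allFin m) (λ p → [ ⌊ a Fin.≟ p ⌋ ] * f p) ≈ f a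
  ∑ₗ-δ {m} a f = trans (reflexive (∑ₗ-tabulate {n = m} id (λ p → [ ⌊ a Fin.≟ p ⌋ ] * f p))) (∑-δ a f)

-- With indices = allX, Mat, _≈ᴹ_, O, _⊕_, _·_ and _⊙_ are definitionally those of Defs.Algebras.
module SquareMatrices {c ℓ} (R : CommutativeSemiring c ℓ) {I : Set} (indices : List I) where
  open CommutativeSemiring R hiding (zero)
  open ListSum R
  open import Algebra.Properties.CommutativeSemigroup *-commutativeSemigroup using () renaming (x∙yz≈y∙xz to x*[y*z]≈y*[x*z])
  open import Relation.Binary.Reasoning.Setoid setoid

  Mat : Set c
  Mat = I → I → Carrier

  infix 4 _≈ᴹ_
  infixl 6 _⊕_
  infixl 7 _⊙_ _·_

  _≈ᴹ_ : Mat → Mat → Set ℓ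
  M ≈ᴹ N = ∀ a b → M a b ≈ N a b

  O : Mat
  O _ _ = 0#

  _⊕_ : Mat → Mat → Mat
  (M ⊕ N) a b = M a b + N a b

  _·_ : Carrier → Mat → Mat
  (s · M) a b = s * M a b

  _⊙_ : Mat → Mat → Mat
  (M ⊙ N) a b = ∑ₗ indices (λ z → M a z * N z b)

  ≈ᴹ-refl : ∀ {M} → M ≈ᴹ M
  ≈ᴹ-refl a b = refl

  ≈ᴹ-sym : ∀ {M N} → M ≈ᴹ N → N ≈ᴹ M
  ≈ᴹ-sym M≈N a b = sym (M≈N a b)

  ≈ᴹ-trans : ∀ {M N P} → M ≈ᴹ N → N ≈ᴹ P → M ≈ᴹ P
  ≈ᴹ-trans M≈N N≈P a b = trans (M≈N a b) (N≈P a b)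

  ⊕-cong : ∀ {M M′ N N′} → M ≈ᴹ M′ → N ≈ᴹ N′ → M ⊕ N ≈ᴹ M′ ⊕ N′
  ⊕-cong M≈ N≈ a b = +-cong (M≈ a b) (N≈ a b)

  ·-cong : ∀ {s s′ M M′} → s ≈ s′ → M ≈ᴹ M′ → s · M ≈ᴹ s′ · M′
  ·-cong s≈ M≈ a b = *-cong s≈ (M≈ a b)

  ⊙-cong : ∀ {M M′ N N′} → M ≈ᴹ M′ → N ≈ᴹ N′ → M ⊙ N ≈ᴹ M′ ⊙ N′
  ⊙-cong M≈ N≈ a b = ∑ₗ-cong indices (λ z → *-cong (M≈ a z) (N≈ z b))

  ⊙-assoc : ∀ M N P → (M ⊙ N) ⊙ P ≈ᴹ M ⊙ (N ⊙ P)
  ⊙-assoc M N P a b = begin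
    ∑ₗ indices (λ w → ∑ₗ indices (λ v → M a v * N v w) * P w b)
      ≈⟨ ∑ₗ-cong indices (λ w → *-distribʳ-∑ₗ indices (P w b) (λ v → M a v * N v w)) ⟩
    ∑ₗ indices (λ w → ∑ₗ indices (λ v → (M a v * N v w) * P w b))
      ≈⟨ ∑ₗ-comm indices indices (λ w v → (M a v * N v w) * P w b) ⟩
    ∑ₗ indices (λ v → ∑ₗ indices (λ w → (M a v * N v w) * P w b))
      ≈⟨ ∑ₗ-cong indices (λ v → ∑ₗ-cong indices (λ w → *-assoc (M a v) (N v w) (P w b))) ⟩
    ∑ₗ indices (λ v → ∑ₗ indices (λ w → M a v * (N v w * P w b)))
      ≈⟨ ∑ₗ-cong indices (λ v → *-distribˡ-∑ₗ indices (M a v) (λ w → N v w * P w b)) ⟨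
    ∑ₗ indices (λ v → M a v * ∑ₗ indices (λ w → N v w * P w b)) ∎

  ⊙-distribˡ : ∀ M N P → M ⊙ (N ⊕ P) ≈ᴹ M ⊙ N ⊕ M ⊙ P
  ⊙-distribˡ M N P a b =
    trans (∑ₗ-cong indices (λ z → distribˡ (M a z) (N z b) (P z b))) (∑ₗ-distrib-+ indices _ _)

  ⊙-distribʳ : ∀ M N P → (N ⊕ P) ⊙ M ≈ᴹ N ⊙ M ⊕ P ⊙ M
  ⊙-distribʳ M N P a b =
    trans (∑ₗ-cong indices (λ z → distribʳ (M z b) (N a z) (P a z))) (∑ₗ-distrib-+ indices _ _)

  ⊙-zeroˡ : ∀ M → O ⊙ M ≈ᴹ O
  ⊙-zeroˡ M a b = trans (∑ₗ-cong indices (λ z → zeroˡ (M z b))) (∑ₗ-zero indices)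

  ⊙-zeroʳ : ∀ M → M ⊙ O ≈ᴹ O
  ⊙-zeroʳ M a b = trans (∑ₗ-cong indices (λ z → zeroʳ (M a z))) (∑ₗ-zero indices)

  ·-⊙-assoc : ∀ s M N → (s · M) ⊙ N ≈ᴹ s · (M ⊙ N)
  ·-⊙-assoc s M N a b =
    trans (∑ₗ-cong indices (λ z → *-assoc s (M a z) (N z b))) (sym (*-distribˡ-∑ₗ indices s _))

  ⊙-·-comm : ∀ s M N → M ⊙ (s · N) ≈ᴹ s · (M ⊙ N)
  ⊙-·-comm s M N a b =
    trans (∑ₗ-cong indices (λ z → x*[y*z]≈y*[x*z] (M a z) s (N z b))) (sym (*-distribˡ-∑ₗ indices s _))

  ≈ᴹ-setoid : Setoid c ℓ
  ≈ᴹ-setoid = record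
    { Carrier       = Mat
    ; _≈_           = _≈ᴹ_
    ; isEquivalence = record { refl = ≈ᴹ-refl ; sym = ≈ᴹ-sym ; trans = ≈ᴹ-trans }
    }

  Symmetricᴹ : Mat → Set ℓ
  Symmetricᴹ M = ∀ a b → M a b ≈ M b a

  ⊙-transpose : ∀ {M N} → Symmetricᴹ M → Symmetricᴹ N → ∀ a b → (M ⊙ N) a b ≈ (N ⊙ M) b a
  ⊙-transpose {M} {N} M-sym N-sym a b =
    ∑ₗ-cong indices (λ z → trans (*-cong (M-sym a z) (N-sym z b)) (*-comm (M z a) (N b z)))

  symmetric-product⇒commute : ∀ {M N} → Symmetricᴹ M → Symmetricᴹ N → Symmetricᴹ (M ⊙ N) → M ⊙ N ≈ᴹ N ⊙ M
  symmetric-product⇒commute M-sym N-sym MN-sym a b = trans (MN-sym a b) (⊙-transpose M-sym N-sym b a)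

-- One coordinate: the scheme on Uⱼ and the factor of C_τ

module Coordinate where
  open import Data.Nat using (_+_; _*_; _∸_)
  open ListSum ℕ.+-*-commutativeSemiring
  open import Algebra.Properties.CommutativeSemigroup ℕ.*-commutativeSemigroup using (x∙yz≈y∙xz; xy∙z≈xz∙y)
  open ≡ using (refl; sym; trans; cong; cong₂; subst; subst₂; module ≡-Reasoning)

  -- k_τ = ∏ⱼ kᶜ (J₁ j) (J₂ j) (J₃ j) ℓⱼ mⱼ.
  kᶜ : (J₁ J₂ J₃ : Bool) (L M : ℕ) → ℕ
  kᶜ J₁ J₂ J₃ L M = (if J₁ then M ∸ 1 else 1) * ((if J₂ then (L ∸ 1) * M else 1) * (if J₃ ∧ not J₂ then M else 1))

  -- The coordinate factor of E*_i A_a E*_i at (u, v), where ru = r u, c = rel u v and rv = r v.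
  Tᶜ : (i a ru c rv : Fin 3) → ℕ
  Tᶜ i a ru c rv = [ ⌊ ru Fin.≟ i ⌋ ] * ([ ⌊ c Fin.≟ a ⌋ ] * [ ⌊ rv Fin.≟ i ⌋ ])

  -- How τ ∈ 𝒰_{g,g} looks at one coordinate j (the index is gⱼ):
  -- j ∉ J₁ ∪ J₃, j ∈ J₁, j ∈ J₃ ∖ J₂ or j ∈ J₂.
  data Kind : Fin 3 → (J₁ J₂ J₃ L>2 M>2 : Bool) → Set where
    kind∅ : ∀ {g L>2 M>2} → Kind g false false false L>2 M>2
    kind₁ : ∀ {L>2} → Kind 1F true false false L>2 true
    kind₃ : ∀ {L>2 M>2} → Kind 2F false false true L>2 M>2
    kind₂ : ∀ {M>2} → Kind 2F false true true true M>2

  kind : ∀ g J₁ J₂ J₃ L>2 M>2 →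
         (T J₁ → T ((⌊ g Fin.≟ 1F ⌋ ∧ ⌊ g Fin.≟ 1F ⌋) ∧ M>2)) →
         (T J₂ → T ((⌊ g Fin.≟ 2F ⌋ ∧ ⌊ g Fin.≟ 2F ⌋) ∧ L>2)) →
         (T J₂ → T J₃) →
         (T J₃ → T (⌊ g Fin.≟ 2F ⌋ ∧ ⌊ g Fin.≟ 2F ⌋)) →
         Kind g J₁ J₂ J₃ L>2 M>2
  kind _  false false false _     _     _  _  _   _  = kind∅
  kind 1F true  false false _     true  _  _  _   _  = kind₁
  kind 2F false false true  _     _     _  _  _   _  = kind₃
  kind 2F false true  true  true  _     _  _  _   _  = kind₂
  kind 0F true  _     _     _     _     J₁ _  _   _  = ⊥-elim (J₁ tt)
  kind 1F true  false false _     false J₁ _  _   _  = ⊥-elim (J₁ tt)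
  kind 2F true  _     _     _     _     J₁ _  _   _  = ⊥-elim (J₁ tt)
  kind 0F false true  _     _     _     _  J₂ _   _  = ⊥-elim (J₂ tt)
  kind 1F _     true  _     _     _     _  J₂ _   _  = ⊥-elim (J₂ tt)
  kind 2F false true  true  false _     _  J₂ _   _  = ⊥-elim (J₂ tt)
  kind _  _     true  false _     _     _  _  J₂₃ _  = ⊥-elim (J₂₃ tt)
  kind 0F false false true  _     _     _  _  _   J₃ = ⊥-elim (J₃ tt)
  kind 1F _     false true  _     _     _  _  _   J₃ = ⊥-elim (J₃ tt)

  -- The triples (r u, r v, rel u v), r = rel x₀, realised by points u, v of a factor;
  -- base is x₀, inner the rest of its block, outer the other blocks.
  data Realisable : (L>2 M>2 : Bool) → Fin 3 → Fin 3 → Fin 3 → Set where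
    base-base         : ∀ {L>2 M>2} → Realisable L>2 M>2 0F 0F 0F
    base-inner        : ∀ {L>2 M>2} → Realisable L>2 M>2 0F 1F 1F
    base-outer        : ∀ {L>2 M>2} → Realisable L>2 M>2 0F 2F 2F
    inner-base        : ∀ {L>2 M>2} → Realisable L>2 M>2 1F 0F 1F
    outer-base        : ∀ {L>2 M>2} → Realisable L>2 M>2 2F 0F 2F
    inner-same        : ∀ {L>2 M>2} → Realisable L>2 M>2 1F 1F 0F
    inner-distinct    : ∀ {L>2} → Realisable L>2 true 1F 1F 1F
    inner-outer       : ∀ {L>2 M>2} → Realisable L>2 M>2 1F 2F 2F
    outer-inner       : ∀ {L>2 M>2} → Realisable L>2 M>2 2F 1F 2F
    outer-same        : ∀ {L>2 M>2} → Realisable L>2 M>2 2F 2F 0F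
    outer-sameBlock   : ∀ {L>2 M>2} → Realisable L>2 M>2 2F 2F 1F
    outer-otherBlocks : ∀ {M>2} → Realisable true M>2 2F 2F 2F

  module Entry (J₁ J₂ J₃ L>2 M>2 : Bool) (L M : ℕ) where

    -- The coordinate factor of the ⊆ᵇ tests on a in B i i (i ⋂ τ); the doubled conjuncts come from
    -- S₁ g ∩ S₁ h with g = h = i.
    allowed : Fin 3 → Fin 3 → Bool
    allowed i a =
      (not (⌊ a Fin.≟ 1F ⌋ ∧ ((⌊ i Fin.≟ 1F ⌋ ∧ ⌊ i Fin.≟ 1F ⌋) ∧ M>2)) ∨ (⌊ i Fin.≟ 1F ⌋ ∧ J₁)) ∧
      ((not (⌊ a Fin.≟ 2F ⌋ ∧ ((⌊ i Fin.≟ 2F ⌋ ∧ ⌊ i Fin.≟ 2F ⌋) ∧ L>2)) ∨ (⌊ i Fin.≟ 2F ⌋ ∧ J₂)) ∧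
       (not (⌊ a Fin.≟ 1F ⌋ ∧ (⌊ i Fin.≟ 2F ⌋ ∧ ⌊ i Fin.≟ 2F ⌋)) ∨ (⌊ i Fin.≟ 2F ⌋ ∧ J₃)))

    k : ℕ
    k = kᶜ J₁ J₂ J₃ L M

    k∖ : Fin 3 → ℕ
    k∖ i = kᶜ (J₁ ∧ not ⌊ i Fin.≟ 1F ⌋) (J₂ ∧ not ⌊ i Fin.≟ 2F ⌋) (J₃ ∧ not ⌊ i Fin.≟ 2F ⌋) L M

    -- The coordinate factor of C_τ at (u, v), as a function of (r u, r v, rel u v).
    Φ : Fin 3 → Fin 3 → Fin 3 → ℕ
    Φ a b c = if ⌊ b Fin.≟ a ⌋ ∧ allowed a c then k∖ a else 0

    special : ∀ {g} → Kind g J₁ J₂ J₃ L>2 M>2 → Fin 3 → Bool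
    special kind∅ a = false
    special kind₁ a = ⌊ a Fin.≟ 1F ⌋
    special kind₃ a = ⌊ a Fin.≟ 2F ⌋
    special kind₂ a = ⌊ a Fin.≟ 2F ⌋

    clique : ∀ {g} → Kind g J₁ J₂ J₃ L>2 M>2 → Fin 3 → Fin 3 → ℕ
    clique kind∅ b c = 0
    clique kind₁ b c = [ ⌊ b Fin.≟ 1F ⌋ ]
    clique kind₃ b c = [ not ⌊ c Fin.≟ 2F ⌋ ]
    clique kind₂ b c = [ ⌊ b Fin.≟ 2F ⌋ ]

    shape : ∀ {g} → Kind g J₁ J₂ J₃ L>2 M>2 → Fin 3 → Fin 3 → Fin 3 → ℕ
    shape κ a b c = if special κ a then clique κ b c else (if ⌊ c Fin.≟ 0F ⌋ then k else 0)

    Φ≡shape : ∀ {g} (κ : Kind g J₁ J₂ J₃ L>2 M>2) {a b c} → Realisable L>2 M>2 a b c → Φ a b c ≡ shape κ a b c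
    Φ≡shape kind∅ = λ { base-base → refl ; base-inner → refl ; base-outer → refl ; inner-base → refl
                      ; outer-base → refl ; inner-same → refl ; inner-distinct → refl ; inner-outer → refl
                      ; outer-inner → refl ; outer-same → refl ; outer-sameBlock → refl ; outer-otherBlocks → refl }
    Φ≡shape kind₁ = λ { base-base → refl ; base-inner → refl ; base-outer → refl ; inner-base → refl
                      ; outer-base → refl ; inner-same → refl ; inner-distinct → refl ; inner-outer → refl
                      ; outer-inner → refl ; outer-same → refl ; outer-sameBlock → refl ; outer-otherBlocks → refl }
    Φ≡shape kind₃ = λ { base-base → refl ; base-inner → refl ; base-outer → refl ; inner-base → refl
                      ; outer-base → refl ; inner-same → refl ; inner-distinct → refl ; inner-outer → refl
                      ; outer-inner → refl ; outer-same → refl ; outer-sameBlock → refl ; outer-otherBlocks → refl }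
    Φ≡shape kind₂ = λ { base-base → refl ; base-inner → refl ; base-outer → refl ; inner-base → refl
                      ; outer-base → refl ; inner-same → refl ; inner-distinct → refl ; inner-outer → refl
                      ; outer-inner → refl ; outer-same → refl ; outer-sameBlock → refl ; outer-otherBlocks → refl }

    Φ-off : ∀ {a b} c → ¬ b ≡ a → Φ a b c ≡ 0
    Φ-off c b≢a rewrite ⌊≟⌋-≢ b≢a = refl

    Φ-sym : ∀ a b c → Φ a b c ≡ Φ b a c
    Φ-sym a b c = by-cases (a Fin.≟ b)
      where
      by-cases : Dec (a ≡ b) → Φ a b c ≡ Φ b a c
      by-cases (yes a≡b) = subst (λ b → Φ a b c ≡ Φ b a c) a≡b refl
      by-cases (no a≢b)  = trans (Φ-off c (a≢b ∘ sym)) (sym (Φ-off c a≢b))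

    Φ-E* : ∀ a b c h → Φ a b c * [ ⌊ b Fin.≟ h ⌋ ] ≡ [ ⌊ a Fin.≟ h ⌋ ] * Φ a b c
    Φ-E* a b c h = by-cases (b Fin.≟ a)
      where
      by-cases : Dec (b ≡ a) → Φ a b c * [ ⌊ b Fin.≟ h ⌋ ] ≡ [ ⌊ a Fin.≟ h ⌋ ] * Φ a b c
      by-cases (yes b≡a) =
        subst (λ b → Φ a b c * [ ⌊ b Fin.≟ h ⌋ ] ≡ [ ⌊ a Fin.≟ h ⌋ ] * Φ a b c) (sym b≡a) (ℕ.*-comm (Φ a a c) _)
      by-cases (no b≢a)  rewrite Φ-off c b≢a = sym (ℕ.*-zeroʳ [ ⌊ a Fin.≟ h ⌋ ])

    Φ-diag : ∀ {g} → Kind g J₁ J₂ J₃ L>2 M>2 → Φ g g 0F ≡ 1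
    Φ-diag (kind∅ {0F}) = refl
    Φ-diag (kind∅ {1F}) = refl
    Φ-diag (kind∅ {2F}) = refl
    Φ-diag kind₁        = refl
    Φ-diag kind₃        = refl
    Φ-diag kind₂        = refl

    Φ-collapse : ∀ ru c rv →
                 ∑ₗ (allFin 3) (λ i → k∖ i * ∑ₗ (allFin 3) (λ a → [ allowed i a ] * Tᶜ i a ru c rv)) ≡ Φ ru rv c
    Φ-collapse ru c rv = begin
      ∑ₗ (allFin 3) (λ i → k∖ i * ∑ₗ (allFin 3) (λ a → [ allowed i a ] * Tᶜ i a ru c rv))
        ≡⟨ ∑ₗ-cong (allFin 3) (λ i → cong (k∖ i *_) (sum-over-a i)) ⟩
      ∑ₗ (allFin 3) (λ i → k∖ i * ([ allowed i c ] * (δ ru i * δ rv i)))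
        ≡⟨ trans (∑ₗ-cong (allFin 3) pull-δ-ru) (∑ₗ-δ ru (λ i → k∖ i * ([ allowed i c ] * δ rv i))) ⟩
      k∖ ru * ([ allowed ru c ] * δ rv ru)
        ≡⟨ select (k∖ ru) (allowed ru c) ⌊ rv Fin.≟ ru ⌋ ⟩
      Φ ru rv c ∎
      where
      open ≡-Reasoning
      δ : Fin 3 → Fin 3 → ℕ
      δ a b = [ ⌊ a Fin.≟ b ⌋ ]
      pull-δ-c : ∀ i a → [ allowed i a ] * Tᶜ i a ru c rv ≡ δ c a * ([ allowed i a ] * (δ ru i * δ rv i))
      pull-δ-c i a =
        trans (cong ([ allowed i a ] *_) (x∙yz≈y∙xz (δ ru i) (δ c a) (δ rv i))) (x∙yz≈y∙xz [ allowed i a ] (δ c a) _)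
      sum-over-a : ∀ i → ∑ₗ (allFin 3) (λ a → [ allowed i a ] * Tᶜ i a ru c rv) ≡ [ allowed i c ] * (δ ru i * δ rv i)
      sum-over-a i = trans (∑ₗ-cong (allFin 3) (pull-δ-c i)) (∑ₗ-δ c (λ a → [ allowed i a ] * (δ ru i * δ rv i)))
      pull-δ-ru : ∀ i → k∖ i * ([ allowed i c ] * (δ ru i * δ rv i)) ≡ δ ru i * (k∖ i * ([ allowed i c ] * δ rv i))
      pull-δ-ru i = trans (cong (k∖ i *_) (x∙yz≈y∙xz [ allowed i c ] (δ ru i) (δ rv i))) (x∙yz≈y∙xz (k∖ i) (δ ru i) _)
      select : ∀ n b b′ → n * ([ b ] * [ b′ ]) ≡ (if b′ ∧ b then n else 0)
      select n true  true  = ℕ.*-identityʳ n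
      select n true  false = ℕ.*-zeroʳ n
      select n false true  = ℕ.*-zeroʳ n
      select n false false = ℕ.*-zeroʳ n

  if-then-else-0 : ∀ b n → (if b then n else 0) ≡ n * [ b ]
  if-then-else-0 true  n = sym (ℕ.*-identityʳ n)
  if-then-else-0 false n = sym (ℕ.*-zeroʳ n)

  1F⇒≢2F : ∀ (a : Fin 3) → ⌊ a Fin.≟ 1F ⌋ ≡ true → ⌊ a Fin.≟ 2F ⌋ ≡ false
  1F⇒≢2F 1F _ = refl

  1*[1*n]≡n : ∀ n → 1 * (1 * n) ≡ n
  1*[1*n]≡n n = trans (ℕ.*-identityˡ (1 * n)) (ℕ.*-identityˡ n)

  1*[n*1]≡n : ∀ n → 1 * (n * 1) ≡ n
  1*[n*1]≡n n = trans (ℕ.*-identityˡ (n * 1)) (ℕ.*-identityʳ n)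

  three-distinct : ∀ {m} {a b c : Fin m} → ¬ a ≡ b → ¬ a ≡ c → ¬ b ≡ c → T (2 ℕ.<ᵇ m)
  three-distinct {suc (suc (suc m))} _ _ _ = tt
  three-distinct {suc (suc zero)} {zero}  {zero}  a≢b _ _ = a≢b refl
  three-distinct {suc (suc zero)} {suc zero} {suc zero} a≢b _ _ = a≢b refl
  three-distinct {suc (suc zero)} {zero}  {suc zero} {zero}  _ a≢c _ = a≢c refl
  three-distinct {suc (suc zero)} {suc zero} {zero}  {suc zero} _ a≢c _ = a≢c refl
  three-distinct {suc (suc zero)} {zero}  {suc zero} {suc zero} _ _ b≢c = b≢c refl
  three-distinct {suc (suc zero)} {suc zero} {zero}  {zero}  _ _ b≢c = b≢c refl
  three-distinct {suc zero} {zero} {zero} a≢b _ _ = a≢b refl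

  inner-distinct′ : ∀ {L>2 M>2} → T M>2 → Realisable L>2 M>2 1F 1F 1F
  inner-distinct′ {M>2 = true} _ = inner-distinct

  outer-otherBlocks′ : ∀ {L>2 M>2} → T L>2 → Realisable L>2 M>2 2F 2F 2F
  outer-otherBlocks′ {true} _ = outer-otherBlocks

  other : ∀ {m} → 2 ℕ.≤ m → Fin m → Fin m
  other (ℕ.s≤s (ℕ.s≤s _)) zero    = suc zero
  other (ℕ.s≤s (ℕ.s≤s _)) (suc _) = zero

  other-≢ : ∀ {m} (2≤m : 2 ℕ.≤ m) a → ¬ a ≡ other 2≤m a
  other-≢ (ℕ.s≤s (ℕ.s≤s _)) zero    ()
  other-≢ (ℕ.s≤s (ℕ.s≤s _)) (suc _) ()

  ∑-1 : ∀ m → sum {m} (λ _ → 1) ≡ m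
  ∑-1 zero    = refl
  ∑-1 (suc m) = cong suc (∑-1 m)

  ∑-≢ : ∀ {m} (a : Fin m) → sum (λ p → [ not ⌊ a Fin.≟ p ⌋ ]) ≡ m ∸ 1
  ∑-≢ {suc m}       zero    = ∑-1 m
  ∑-≢ {suc (suc m)} (suc a) =
    cong suc (trans (sum-cong-≋ {suc m} (λ p → cong (λ b → [ not b ]) (⌊suc≟suc⌋ a p))) (∑-≢ a))

  ∑-≟ : ∀ {m} (a : Fin m) → sum (λ p → [ ⌊ a Fin.≟ p ⌋ ]) ≡ 1
  ∑-≟ {m} a = trans (sum-cong-≋ {m} (λ p → sym (ℕ.*-identityʳ _))) (∑-δ a (λ _ → 1))

  module Factor (L M : ℕ) (x₀ : Fin L × Fin M) where
    open ≡-Reasoning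

    Pt : Set
    Pt = Fin L × Fin M

    pts : List Pt
    pts = cartesianProduct (allFin L) (allFin M)

    -- As Scheme.relU, so that rel (y j) (z j) unfolds to the j-th entry of Scheme.rel y z.
    rel : Pt → Pt → Fin 3
    rel (b₁ , p₁) (b₂ , p₂) = if ⌊ b₁ Fin.≟ b₂ ⌋ then (if ⌊ p₁ Fin.≟ p₂ ⌋ then 0F else 1F) else 2F

    r : Pt → Fin 3
    r = rel x₀

    bx : Fin L
    bx = proj₁ x₀

    px : Fin M
    px = proj₂ x₀

    δ sameBlock : Pt → Pt → ℕ
    δ u v = [ ⌊ proj₁ u Fin.≟ proj₁ v ⌋ ∧ ⌊ proj₂ u Fin.≟ proj₂ v ⌋ ]
    sameBlock u v = [ ⌊ proj₁ u Fin.≟ proj₁ v ⌋ ]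

    adj : Fin 3 → Pt → Pt → ℕ
    adj h u v = [ ⌊ rel u v Fin.≟ h ⌋ ]

    E*ᶜ : Fin 3 → Pt → Pt → ℕ
    E*ᶜ h u v = [ ⌊ r u Fin.≟ h ⌋ ] * δ u v

    ones : Pt → Pt → ℕ
    ones _ _ = 1

    open SquareMatrices ℕ.+-*-commutativeSemiring pts public

    rel≟0F : ∀ u v → ⌊ rel u v Fin.≟ 0F ⌋ ≡ ⌊ proj₁ u Fin.≟ proj₁ v ⌋ ∧ ⌊ proj₂ u Fin.≟ proj₂ v ⌋
    rel≟0F (b , p) (b′ , p′) with b Fin.≟ b′ | p Fin.≟ p′
    ... | yes _ | yes _ = refl
    ... | yes _ | no _  = refl
    ... | no _  | _     = refl

    rel≟1F : ∀ u v → ⌊ rel u v Fin.≟ 1F ⌋ ≡ ⌊ proj₁ u Fin.≟ proj₁ v ⌋ ∧ not ⌊ proj₂ u Fin.≟ proj₂ v ⌋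
    rel≟1F (b , p) (b′ , p′) with b Fin.≟ b′ | p Fin.≟ p′
    ... | yes _ | yes _ = refl
    ... | yes _ | no _  = refl
    ... | no _  | _     = refl

    rel≟2F : ∀ u v → ⌊ rel u v Fin.≟ 2F ⌋ ≡ not ⌊ proj₁ u Fin.≟ proj₁ v ⌋
    rel≟2F (b , p) (b′ , p′) with b Fin.≟ b′ | p Fin.≟ p′
    ... | yes _ | yes _ = refl
    ... | yes _ | no _  = refl
    ... | no _  | _     = refl

    rel-sym : ∀ u v → rel u v ≡ rel v u
    rel-sym (b , p) (b′ , p′) rewrite ⌊≟⌋-sym b b′ | ⌊≟⌋-sym p p′ = refl

    rel-refl : ∀ u → rel u u ≡ 0F
    rel-refl (b , p) rewrite ⌊≟⌋-refl b | ⌊≟⌋-refl p = refl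

    [rel≢2F] : ∀ u v → [ not ⌊ rel u v Fin.≟ 2F ⌋ ] ≡ sameBlock u v
    [rel≢2F] u v = cong [_] (trans (cong not (rel≟2F u v)) (not-involutive _))

    δ-sym : Symmetricᴹ δ
    δ-sym (b , p) (b′ , p′) = cong₂ (λ x y → [ x ∧ y ]) (⌊≟⌋-sym b b′) (⌊≟⌋-sym p p′)

    sameBlock-sym : Symmetricᴹ sameBlock
    sameBlock-sym (b , _) (b′ , _) = cong [_] (⌊≟⌋-sym b b′)

    sameBlock-of-base-block : ∀ u v → ⌊ r u Fin.≟ 2F ⌋ ≡ false → sameBlock u v ≡ [ not ⌊ r v Fin.≟ 2F ⌋ ]
    sameBlock-of-base-block (bu , pu) v ru≢2 with bx Fin.≟ bu
    ... | yes refl = sym ([rel≢2F] x₀ v)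
    ... | no _     with () ← ru≢2

    adj-0F : adj 0F ≈ᴹ δ
    adj-0F u v = cong [_] (rel≟0F u v)

    adj-0F⊕adj-1F : adj 0F ⊕ adj 1F ≈ᴹ sameBlock
    adj-0F⊕adj-1F (b , p) (b′ , p′) with b Fin.≟ b′ | p Fin.≟ p′
    ... | yes _ | yes _ = refl
    ... | yes _ | no _  = refl
    ... | no _  | _     = refl

    sameBlock⊕adj-2F : sameBlock ⊕ adj 2F ≈ᴹ ones
    sameBlock⊕adj-2F (b , p) (b′ , p′) with b Fin.≟ b′ | p Fin.≟ p′
    ... | yes _ | yes _ = refl
    ... | yes _ | no _  = refl
    ... | no _  | _     = refl

    realisable : ∀ u v → Realisable (2 <ᵇ L) (2 <ᵇ M) (r u) (r v) (rel u v)
    realisable (bu , pu) (bv , pv) with bu Fin.≟ bv | pu Fin.≟ pv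
    ... | yes refl | yes refl with bx Fin.≟ bu
    ...   | no _ = outer-same
    ...   | yes _ with px Fin.≟ pu
    ...     | yes _ = base-base
    ...     | no _  = inner-same
    realisable (bu , pu) (bv , pv) | yes refl | no pu≢pv with bx Fin.≟ bu
    ...   | no _ = outer-sameBlock
    ...   | yes _ with px Fin.≟ pu | px Fin.≟ pv
    ...     | yes refl | yes refl = ⊥-elim (pu≢pv refl)
    ...     | yes _    | no _     = base-inner
    ...     | no _     | yes _    = inner-base
    ...     | no px≢pu | no px≢pv = inner-distinct′ (three-distinct px≢pu px≢pv pu≢pv)
    realisable (bu , pu) (bv , pv) | no bu≢bv | _ with bx Fin.≟ bu | bx Fin.≟ bv
    ...   | yes refl | yes refl = ⊥-elim (bu≢bv refl)
    ...   | yes _    | no _ with px Fin.≟ pu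
    ...     | yes _ = base-outer
    ...     | no _  = inner-outer
    realisable (bu , pu) (bv , pv) | no bu≢bv | _ | no _ | yes _ with px Fin.≟ pv
    ...     | yes _ = outer-base
    ...     | no _  = outer-inner
    realisable (bu , pu) (bv , pv) | no bu≢bv | _ | no bx≢bu | no bx≢bv = outer-otherBlocks′ (three-distinct bx≢bu bx≢bv bu≢bv)

    point : 2 ℕ.≤ L → 2 ℕ.≤ M → Fin 3 → Pt
    point _   _   0F = x₀
    point _   2≤M 1F = bx , other 2≤M px
    point 2≤L _   2F = other 2≤L bx , px

    r-point : ∀ 2≤L 2≤M g → r (point 2≤L 2≤M g) ≡ g
    r-point _   _   0F = rel-refl x₀
    r-point _   2≤M 1F rewrite ⌊≟⌋-refl bx | ⌊≟⌋-≢ (other-≢ 2≤M px) = refl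
    r-point 2≤L _   2F rewrite ⌊≟⌋-≢ (other-≢ 2≤L bx) = refl

    ∑-pts : (f : Pt → ℕ) → ∑ₗ pts f ≡ sum (λ b → sum (λ p → f (b , p)))
    ∑-pts f = begin
      ∑ₗ pts f                                               ≡⟨ go (allFin L) ⟩
      ∑ₗ (allFin L) (λ b → ∑ₗ (allFin M) (λ p → f (b , p))) ≡⟨ ∑ₗ-tabulate {n = L} id (λ b → ∑ₗ (allFin M) (λ p → f (b , p))) ⟩
      sum (λ b → ∑ₗ (allFin M) (λ p → f (b , p)))           ≡⟨ sum-cong-≋ {L} (λ b → ∑ₗ-tabulate {n = M} id (λ p → f (b , p))) ⟩
      sum (λ b → sum (λ p → f (b , p)))                      ∎
      where
      go : (bs : List (Fin L)) → ∑ₗ (cartesianProduct bs (allFin M)) f ≡ ∑ₗ bs (λ b → ∑ₗ (allFin M) (λ p → f (b , p)))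
      go []       = refl
      go (b ∷ bs) = trans (∑ₗ-++ (map (b ,_) (allFin M)) _ f) (cong₂ _+_ (∑ₗ-map (b ,_) (allFin M) f) (go bs))

    ∑-pts-separable : (f : Fin L → ℕ) (g : Fin M → ℕ) → ∑ₗ pts (λ w → f (proj₁ w) * g (proj₂ w)) ≡ sum f * sum g
    ∑-pts-separable f g = begin
      ∑ₗ pts (λ w → f (proj₁ w) * g (proj₂ w)) ≡⟨ ∑-pts _ ⟩
      sum (λ b → sum (λ p → f b * g p))       ≡⟨ sum-cong-≋ {L} (λ b → *-distribˡ-sum {M} (f b) g) ⟨
      sum (λ b → f b * sum g)                 ≡⟨ *-distribʳ-sum {L} (sum g) f ⟨
      sum f * sum g                           ∎

    ∑-pts-δ : ∀ u (f : Pt → ℕ) → ∑ₗ pts (λ w → δ u w * f w) ≡ f u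
    ∑-pts-δ (b₀ , p₀) f = begin
      ∑ₗ pts (λ w → δ (b₀ , p₀) w * f w)
        ≡⟨ ∑-pts _ ⟩
      sum (λ b → sum (λ p → [ ⌊ b₀ Fin.≟ b ⌋ ∧ ⌊ p₀ Fin.≟ p ⌋ ] * f (b , p)))
        ≡⟨ sum-cong-≋ {L} (λ b → sum-cong-≋ {M} (λ p → split (⌊ b₀ Fin.≟ b ⌋) _ _)) ⟩
      sum (λ b → sum (λ p → [ ⌊ b₀ Fin.≟ b ⌋ ] * ([ ⌊ p₀ Fin.≟ p ⌋ ] * f (b , p))))
        ≡⟨ sum-cong-≋ {L} (λ b → *-distribˡ-sum {M} [ ⌊ b₀ Fin.≟ b ⌋ ] _) ⟨
      sum (λ b → [ ⌊ b₀ Fin.≟ b ⌋ ] * sum (λ p → [ ⌊ p₀ Fin.≟ p ⌋ ] * f (b , p)))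
        ≡⟨ ∑-δ b₀ _ ⟩
      sum (λ p → [ ⌊ p₀ Fin.≟ p ⌋ ] * f (b₀ , p))
        ≡⟨ ∑-δ p₀ _ ⟩
      f (b₀ , p₀) ∎
      where
      split : ∀ x y z → [ x ∧ y ] * z ≡ [ x ] * ([ y ] * z)
      split x y z = trans (cong (_* z) ([∧] x y)) (ℕ.*-assoc [ x ] [ y ] z)

    ∑-scaled-δ : ∀ s u (f : Pt → ℕ) → ∑ₗ pts (λ w → (s * δ u w) * f w) ≡ s * f u
    ∑-scaled-δ s u f = begin
      ∑ₗ pts (λ w → (s * δ u w) * f w) ≡⟨ ∑ₗ-cong pts (λ w → ℕ.*-assoc s (δ u w) (f w)) ⟩
      ∑ₗ pts (λ w → s * (δ u w * f w)) ≡⟨ *-distribˡ-∑ₗ pts s _ ⟨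
      s * ∑ₗ pts (λ w → δ u w * f w)   ≡⟨ cong (s *_) (∑-pts-δ u f) ⟩
      s * f u                          ∎

    δ-⊙ : ∀ m → δ ⊙ m ≈ᴹ m
    δ-⊙ m u v = ∑-pts-δ u (λ w → m w v)

    ⊙-δ : ∀ m → m ⊙ δ ≈ᴹ m
    ⊙-δ m u v = trans (∑ₗ-cong pts (λ w → trans (ℕ.*-comm (m u w) _) (cong (_* m u w) (δ-sym w v)))) (∑-pts-δ v (m u))

    δ-commute : ∀ m → m ⊙ δ ≈ᴹ δ ⊙ m
    δ-commute m = ≈ᴹ-trans (⊙-δ m) (≈ᴹ-sym (δ-⊙ m))

    ∑-r≡1F : ∑ₗ pts (λ w → [ ⌊ r w Fin.≟ 1F ⌋ ]) ≡ M ∸ 1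
    ∑-r≡1F = begin
      ∑ₗ pts (λ w → [ ⌊ r w Fin.≟ 1F ⌋ ])
        ≡⟨ ∑ₗ-cong pts (λ w → trans (cong [_] (rel≟1F x₀ w)) ([∧] ⌊ bx Fin.≟ proj₁ w ⌋ _)) ⟩
      ∑ₗ pts (λ w → [ ⌊ bx Fin.≟ proj₁ w ⌋ ] * [ not ⌊ px Fin.≟ proj₂ w ⌋ ])
        ≡⟨ ∑-pts-separable _ _ ⟩
      sum (λ b → [ ⌊ bx Fin.≟ b ⌋ ]) * sum (λ p → [ not ⌊ px Fin.≟ p ⌋ ])
        ≡⟨ cong₂ _*_ (∑-≟ bx) (∑-≢ px) ⟩
      1 * (M ∸ 1)
        ≡⟨ ℕ.*-identityˡ _ ⟩
      M ∸ 1 ∎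

    ∑-r≡2F : ∑ₗ pts (λ w → [ ⌊ r w Fin.≟ 2F ⌋ ]) ≡ (L ∸ 1) * M
    ∑-r≡2F = begin
      ∑ₗ pts (λ w → [ ⌊ r w Fin.≟ 2F ⌋ ])
        ≡⟨ ∑ₗ-cong pts (λ w → trans (cong [_] (rel≟2F x₀ w)) (sym (ℕ.*-identityʳ _))) ⟩
      ∑ₗ pts (λ w → [ not ⌊ bx Fin.≟ proj₁ w ⌋ ] * 1)
        ≡⟨ ∑-pts-separable _ _ ⟩
      sum (λ b → [ not ⌊ bx Fin.≟ b ⌋ ]) * sum {M} (λ _ → 1)
        ≡⟨ cong₂ _*_ (∑-≢ bx) (∑-1 M) ⟩
      (L ∸ 1) * M ∎

    ∑-δ-block : ∀ (a : Fin L) (f : Fin L → ℕ) → ∑ₗ pts (λ w → [ ⌊ a Fin.≟ proj₁ w ⌋ ] * f (proj₁ w)) ≡ M * f a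
    ∑-δ-block a f = begin
      ∑ₗ pts (λ w → [ ⌊ a Fin.≟ proj₁ w ⌋ ] * f (proj₁ w))
        ≡⟨ ∑ₗ-cong pts (λ w → sym (ℕ.*-identityʳ _)) ⟩
      ∑ₗ pts (λ w → ([ ⌊ a Fin.≟ proj₁ w ⌋ ] * f (proj₁ w)) * 1)
        ≡⟨ ∑-pts-separable _ _ ⟩
      sum (λ b → [ ⌊ a Fin.≟ b ⌋ ] * f b) * sum {M} (λ _ → 1)
        ≡⟨ cong₂ _*_ (∑-δ a f) (∑-1 M) ⟩
      f a * M
        ≡⟨ ℕ.*-comm (f a) M ⟩
      M * f a ∎

    ∑-sameBlock : ∀ u → ∑ₗ pts (sameBlock u) ≡ M
    ∑-sameBlock u =
      trans (∑ₗ-cong pts (λ w → sym (ℕ.*-identityʳ (sameBlock u w)))) (trans (∑-δ-block (proj₁ u) (λ _ → 1)) (ℕ.*-identityʳ M))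

    ∑-sameBlock² : ∀ u v → ∑ₗ pts (λ w → sameBlock u w * sameBlock w v) ≡ M * sameBlock u v
    ∑-sameBlock² u v = ∑-δ-block (proj₁ u) (λ b → [ ⌊ b Fin.≟ proj₁ v ⌋ ])

    ∑-r≡1F-sameBlock : ∀ v →
                       ∑ₗ pts (λ w → [ ⌊ r w Fin.≟ 1F ⌋ ] * sameBlock w v) ≡ (M ∸ 1) * [ not ⌊ r v Fin.≟ 2F ⌋ ]
    ∑-r≡1F-sameBlock v = begin
      ∑ₗ pts (λ w → [ ⌊ r w Fin.≟ 1F ⌋ ] * sameBlock w v)
        ≡⟨ ∑ₗ-cong pts (λ w → trans (cong (_* sameBlock w v) (trans (cong [_] (rel≟1F x₀ w)) ([∧] ⌊ bx Fin.≟ proj₁ w ⌋ _)))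
                                     (xy∙z≈xz∙y [ ⌊ bx Fin.≟ proj₁ w ⌋ ] _ _)) ⟩
      ∑ₗ pts (λ w → ([ ⌊ bx Fin.≟ proj₁ w ⌋ ] * [ ⌊ proj₁ w Fin.≟ proj₁ v ⌋ ]) * [ not ⌊ px Fin.≟ proj₂ w ⌋ ])
        ≡⟨ ∑-pts-separable _ _ ⟩
      sum (λ b → [ ⌊ bx Fin.≟ b ⌋ ] * [ ⌊ b Fin.≟ proj₁ v ⌋ ]) * sum (λ p → [ not ⌊ px Fin.≟ p ⌋ ])
        ≡⟨ cong₂ _*_ (∑-δ bx _) (∑-≢ px) ⟩
      sameBlock x₀ v * (M ∸ 1)
        ≡⟨ cong (_* (M ∸ 1)) ([rel≢2F] x₀ v) ⟨
      [ not ⌊ r v Fin.≟ 2F ⌋ ] * (M ∸ 1)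
        ≡⟨ ℕ.*-comm _ (M ∸ 1) ⟩
      (M ∸ 1) * [ not ⌊ r v Fin.≟ 2F ⌋ ] ∎

    ∑-r≡2F-sameBlock : ∀ v → ∑ₗ pts (λ w → [ ⌊ r w Fin.≟ 2F ⌋ ] * sameBlock w v) ≡ M * [ ⌊ r v Fin.≟ 2F ⌋ ]
    ∑-r≡2F-sameBlock v = begin
      ∑ₗ pts (λ w → [ ⌊ r w Fin.≟ 2F ⌋ ] * sameBlock w v)
        ≡⟨ ∑ₗ-cong pts (λ w → trans (cong₂ _*_ (cong [_] (rel≟2F x₀ w)) (sameBlock-sym w v)) (ℕ.*-comm _ (sameBlock v w))) ⟩
      ∑ₗ pts (λ w → [ ⌊ proj₁ v Fin.≟ proj₁ w ⌋ ] * [ not ⌊ bx Fin.≟ proj₁ w ⌋ ])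
        ≡⟨ ∑-δ-block (proj₁ v) (λ b → [ not ⌊ bx Fin.≟ b ⌋ ]) ⟩
      M * [ not ⌊ bx Fin.≟ proj₁ v ⌋ ]
        ≡⟨ cong (λ b → M * [ b ]) (rel≟2F x₀ v) ⟨
      M * [ ⌊ r v Fin.≟ 2F ⌋ ] ∎

    E*ᶜ⊙adj⊙E*ᶜ : ∀ i a → E*ᶜ i ⊙ adj a ⊙ E*ᶜ i ≈ᴹ λ u v → Tᶜ i a (r u) (rel u v) (r v)
    E*ᶜ⊙adj⊙E*ᶜ i a u v = begin
      ∑ₗ pts (λ w → (E*ᶜ i ⊙ adj a) u w * ([ ⌊ r w Fin.≟ i ⌋ ] * δ w v))
        ≡⟨ ∑ₗ-cong pts (λ w → trans (cong (_* _) (∑-scaled-δ [ ⌊ r u Fin.≟ i ⌋ ] u (λ w′ → adj a w′ w)))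
                                     (sym (ℕ.*-assoc ([ ⌊ r u Fin.≟ i ⌋ ] * adj a u w) [ ⌊ r w Fin.≟ i ⌋ ] (δ w v)))) ⟩
      ∑ₗ pts (λ w → ([ ⌊ r u Fin.≟ i ⌋ ] * adj a u w * [ ⌊ r w Fin.≟ i ⌋ ]) * δ w v)
        ≡⟨ ⊙-δ (λ u′ w → [ ⌊ r u Fin.≟ i ⌋ ] * adj a u w * [ ⌊ r w Fin.≟ i ⌋ ]) u v ⟩
      [ ⌊ r u Fin.≟ i ⌋ ] * adj a u v * [ ⌊ r v Fin.≟ i ⌋ ]
        ≡⟨ ℕ.*-assoc [ ⌊ r u Fin.≟ i ⌋ ] _ _ ⟩
      Tᶜ i a (r u) (rel u v) (r v) ∎

    commute-resp : ∀ {c m m′} → m ≈ᴹ m′ → c ⊙ m ≈ᴹ m ⊙ c → c ⊙ m′ ≈ᴹ m′ ⊙ c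
    commute-resp {c} m≈m′ cm≈mc =
      ≈ᴹ-trans (⊙-cong (≈ᴹ-refl {c}) (≈ᴹ-sym m≈m′)) (≈ᴹ-trans cm≈mc (⊙-cong m≈m′ ≈ᴹ-refl))

    commute-⊕⁻ : ∀ c m n → c ⊙ m ≈ᴹ m ⊙ c → c ⊙ (m ⊕ n) ≈ᴹ (m ⊕ n) ⊙ c → c ⊙ n ≈ᴹ n ⊙ c
    commute-⊕⁻ c m n cm≈mc cmn≈mnc u v = ℕ.+-cancelˡ-≡ ((c ⊙ m) u v) _ _ (begin
      (c ⊙ m) u v + (c ⊙ n) u v ≡⟨ ⊙-distribˡ c m n u v ⟨
      (c ⊙ (m ⊕ n)) u v         ≡⟨ cmn≈mnc u v ⟩
      ((m ⊕ n) ⊙ c) u v         ≡⟨ ⊙-distribʳ c m n u v ⟩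
      (m ⊙ c) u v + (n ⊙ c) u v ≡⟨ cong (_+ _) (cm≈mc u v) ⟨
      (c ⊙ m) u v + (n ⊙ c) u v ∎)

    module CFactor (J₁ J₂ J₃ L>2 M>2 : Bool) (L>2≡ : L>2 ≡ (2 <ᵇ L)) (M>2≡ : M>2 ≡ (2 <ᵇ M)) where
      open Entry J₁ J₂ J₃ L>2 M>2 L M public

      Cᶜ : Pt → Pt → ℕ
      Cᶜ u v = Φ (r u) (r v) (rel u v)

      Cᶜ-sym : Symmetricᴹ Cᶜ
      Cᶜ-sym u v = trans (Φ-sym (r u) (r v) (rel u v)) (cong (Φ (r v) (r u)) (rel-sym u v))

      Cᶜ-commutes-E* : ∀ h → Cᶜ ⊙ E*ᶜ h ≈ᴹ E*ᶜ h ⊙ Cᶜ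
      Cᶜ-commutes-E* h u v = begin
        ∑ₗ pts (λ w → Cᶜ u w * (ind w * δ w v))   ≡⟨ ∑ₗ-cong pts (λ w → ℕ.*-assoc (Cᶜ u w) (ind w) (δ w v)) ⟨
        ∑ₗ pts (λ w → (Cᶜ u w * ind w) * δ w v)   ≡⟨ ⊙-δ (λ u w → Cᶜ u w * ind w) u v ⟩
        Cᶜ u v * ind v                             ≡⟨ Φ-E* (r u) (r v) (rel u v) h ⟩
        ind u * Cᶜ u v                             ≡⟨ cong (ind u *_) (δ-⊙ Cᶜ u v) ⟨
        ind u * ∑ₗ pts (λ w → δ u w * Cᶜ w v)      ≡⟨ *-distribˡ-∑ₗ pts (ind u) _ ⟩
        ∑ₗ pts (λ w → ind u * (δ u w * Cᶜ w v))   ≡⟨ ∑ₗ-cong pts (λ w → ℕ.*-assoc (ind u) (δ u w) (Cᶜ w v)) ⟨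
        ∑ₗ pts (λ w → (ind u * δ u w) * Cᶜ w v)   ∎
        where
        ind : Pt → ℕ
        ind w = [ ⌊ r w Fin.≟ h ⌋ ]

      cliqueᶜ : ∀ {g} → Kind g J₁ J₂ J₃ L>2 M>2 → Pt → Pt → ℕ
      cliqueᶜ κ u w = clique κ (r w) (rel u w)

      -- The value of Cᶜ ⊙ sameBlock, written so that it is visibly symmetric.
      Γ : ∀ {g} → Kind g J₁ J₂ J₃ L>2 M>2 → Pt → Pt → ℕ
      Γ kind₂ u v = if ⌊ r u Fin.≟ 2F ⌋ ∧ ⌊ r v Fin.≟ 2F ⌋ then M else k * sameBlock u v
      Γ kind∅ u v = k * sameBlock u v
      Γ kind₁ u v = k * sameBlock u v
      Γ kind₃ u v = k * sameBlock u v

      Γ-sym : ∀ {g} (κ : Kind g J₁ J₂ J₃ L>2 M>2) → Symmetricᴹ (Γ κ)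
      Γ-sym kind₂ u v = cong₂ (λ b n → if b then M else n) (∧-comm ⌊ r u Fin.≟ 2F ⌋ _) (cong (k *_) (sameBlock-sym u v))
      Γ-sym kind∅ u v = cong (k *_) (sameBlock-sym u v)
      Γ-sym kind₁ u v = cong (k *_) (sameBlock-sym u v)
      Γ-sym kind₃ u v = cong (k *_) (sameBlock-sym u v)

      Γ-off : ∀ {g} (κ : Kind g J₁ J₂ J₃ L>2 M>2) u v → special κ (r u) ≡ false → Γ κ u v ≡ k * sameBlock u v
      Γ-off kind₂ u v off rewrite off = refl
      Γ-off kind∅ u v _ = refl
      Γ-off kind₁ u v _ = refl
      Γ-off kind₃ u v _ = refl

      ∑-clique : ∀ {g} (κ : Kind g J₁ J₂ J₃ L>2 M>2) u → special κ (r u) ≡ true → ∑ₗ pts (cliqueᶜ κ u) ≡ k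
      ∑-clique kind₁ u _ = trans ∑-r≡1F (sym (ℕ.*-identityʳ (M ∸ 1)))
      ∑-clique kind₃ u _ = trans (∑ₗ-cong pts ([rel≢2F] u)) (trans (∑-sameBlock u) (sym (1*[1*n]≡n M)))
      ∑-clique kind₂ u _ = trans ∑-r≡2F (sym (1*[n*1]≡n ((L ∸ 1) * M)))

      ∑-clique² : ∀ {g} (κ : Kind g J₁ J₂ J₃ L>2 M>2) u v → special κ (r u) ≡ true → special κ (r v) ≡ true →
                 ∑ₗ pts (λ w → cliqueᶜ κ u w * cliqueᶜ κ v w) ≡ k * cliqueᶜ κ u v
      ∑-clique² kind₁ u v _ rv≡1 rewrite rv≡1 =
        trans (∑ₗ-cong pts (λ w → [b]*[b] ⌊ r w Fin.≟ 1F ⌋)) (trans ∑-r≡1F (sym (trans (ℕ.*-identityʳ _) (ℕ.*-identityʳ _))))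
      ∑-clique² kind₃ u v _ _ = begin
        ∑ₗ pts (λ w → [ not ⌊ rel u w Fin.≟ 2F ⌋ ] * [ not ⌊ rel v w Fin.≟ 2F ⌋ ])
          ≡⟨ ∑ₗ-cong pts (λ w → cong₂ _*_ ([rel≢2F] u w) (trans ([rel≢2F] v w) (sameBlock-sym v w))) ⟩
        ∑ₗ pts (λ w → sameBlock u w * sameBlock w v)
          ≡⟨ ∑-sameBlock² u v ⟩
        M * sameBlock u v
          ≡⟨ cong₂ _*_ (1*[1*n]≡n M) ([rel≢2F] u v) ⟨
        (1 * (1 * M)) * [ not ⌊ rel u v Fin.≟ 2F ⌋ ] ∎
      ∑-clique² kind₂ u v _ rv≡2 rewrite rv≡2 =
        trans (∑ₗ-cong pts (λ w → [b]*[b] ⌊ r w Fin.≟ 2F ⌋)) (trans ∑-r≡2F (sym (trans (ℕ.*-identityʳ _) (1*[n*1]≡n _))))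

      ∑-clique-sameBlock : ∀ {g} (κ : Kind g J₁ J₂ J₃ L>2 M>2) u v → special κ (r u) ≡ true →
                          ∑ₗ pts (λ w → cliqueᶜ κ u w * sameBlock w v) ≡ Γ κ u v
      ∑-clique-sameBlock kind₁ u v ru≡1 = begin
        ∑ₗ pts (λ w → [ ⌊ r w Fin.≟ 1F ⌋ ] * sameBlock w v)
          ≡⟨ ∑-r≡1F-sameBlock v ⟩
        (M ∸ 1) * [ not ⌊ r v Fin.≟ 2F ⌋ ]
          ≡⟨ cong₂ _*_ (ℕ.*-identityʳ (M ∸ 1)) (sameBlock-of-base-block u v (1F⇒≢2F (r u) ru≡1)) ⟨
        ((M ∸ 1) * 1) * sameBlock u v ∎
      ∑-clique-sameBlock kind₃ u v _ = begin
        ∑ₗ pts (λ w → [ not ⌊ rel u w Fin.≟ 2F ⌋ ] * sameBlock w v)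
          ≡⟨ ∑ₗ-cong pts (λ w → cong (_* sameBlock w v) ([rel≢2F] u w)) ⟩
        ∑ₗ pts (λ w → sameBlock u w * sameBlock w v)
          ≡⟨ ∑-sameBlock² u v ⟩
        M * sameBlock u v
          ≡⟨ cong (_* sameBlock u v) (1*[1*n]≡n M) ⟨
        (1 * (1 * M)) * sameBlock u v ∎
      ∑-clique-sameBlock kind₂ u v ru≡2 with ⌊ r v Fin.≟ 2F ⌋ in rv≟2F
      ... | true  rewrite ru≡2 = trans (∑-r≡2F-sameBlock v) (trans (cong (λ b → M * [ b ]) rv≟2F) (ℕ.*-identityʳ M))
      ... | false rewrite ru≡2 = begin
        ∑ₗ pts (λ w → [ ⌊ r w Fin.≟ 2F ⌋ ] * sameBlock w v)
          ≡⟨ ∑-r≡2F-sameBlock v ⟩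
        M * [ ⌊ r v Fin.≟ 2F ⌋ ]
          ≡⟨ cong (λ b → M * [ b ]) rv≟2F ⟩
        M * 0
          ≡⟨ ℕ.*-zeroʳ M ⟩
        0
          ≡⟨ ℕ.*-zeroʳ k ⟨
        k * [ not true ]
          ≡⟨ cong (λ b → k * [ not b ]) ru≡2 ⟨
        k * [ not ⌊ r u Fin.≟ 2F ⌋ ]
          ≡⟨ cong (k *_) (trans (sameBlock-sym u v) (sameBlock-of-base-block v u rv≟2F)) ⟨
        k * sameBlock u v ∎

      Cᶜ-diag : ∀ {g} → Kind g J₁ J₂ J₃ L>2 M>2 → ∀ y → r y ≡ g → Cᶜ y y ≡ 1
      Cᶜ-diag κ y ry≡g rewrite rel-refl y | ry≡g = Φ-diag κ

      realisableᶜ : ∀ u v → Realisable L>2 M>2 (r u) (r v) (rel u v)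
      realisableᶜ u v = subst₂ (λ L>2 M>2 → Realisable L>2 M>2 (r u) (r v) (rel u v)) (sym L>2≡) (sym M>2≡) (realisable u v)

      module _ {g} (κ : Kind g J₁ J₂ J₃ L>2 M>2) where

        Cᶜ-row-off : ∀ {u} → special κ (r u) ≡ false → ∀ w → Cᶜ u w ≡ k * δ u w
        Cᶜ-row-off {u} off w = begin
          Cᶜ u w                                        ≡⟨ Φ≡shape κ (realisableᶜ u w) ⟩
          shape κ (r u) (r w) (rel u w)                 ≡⟨ cong (λ s → if s then cliqueᶜ κ u w else _) off ⟩
          (if ⌊ rel u w Fin.≟ 0F ⌋ then k else 0)       ≡⟨ if-then-else-0 ⌊ rel u w Fin.≟ 0F ⌋ k ⟩
          k * [ ⌊ rel u w Fin.≟ 0F ⌋ ]                  ≡⟨ cong (k *_) (adj-0F u w) ⟩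
          k * δ u w                                     ∎

        Cᶜ-row-on : ∀ {u} → special κ (r u) ≡ true → ∀ w → Cᶜ u w ≡ cliqueᶜ κ u w
        Cᶜ-row-on {u} on w = trans (Φ≡shape κ (realisableᶜ u w)) (cong (λ s → if s then cliqueᶜ κ u w else _) on)

        Cᶜ-rowsum : ∀ u → ∑ₗ pts (Cᶜ u) ≡ k
        Cᶜ-rowsum u with special κ (r u) in eu
        ... | false = begin
          ∑ₗ pts (Cᶜ u)                         ≡⟨ ∑ₗ-cong pts (λ w → trans (Cᶜ-row-off eu w) (sym (ℕ.*-identityʳ _))) ⟩
          ∑ₗ pts (λ w → (k * δ u w) * 1)        ≡⟨ ∑-scaled-δ k u (λ _ → 1) ⟩
          k * 1                                 ≡⟨ ℕ.*-identityʳ k ⟩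
          k                                     ∎
        ... | true = trans (∑ₗ-cong pts (Cᶜ-row-on eu)) (∑-clique κ u eu)

        Cᶜ-square : Cᶜ ⊙ Cᶜ ≈ᴹ k · Cᶜ
        Cᶜ-square u v = trans (∑ₗ-cong pts (λ w → cong (Cᶜ u w *_) (Cᶜ-sym w v))) (square-rows u v)
          where
          square-rows : ∀ u v → ∑ₗ pts (λ w → Cᶜ u w * Cᶜ v w) ≡ k * Cᶜ u v
          square-rows u v with special κ (r u) in eu | special κ (r v) in ev
          ... | false | _ = begin
            ∑ₗ pts (λ w → Cᶜ u w * Cᶜ v w)
              ≡⟨ ∑ₗ-cong pts (λ w → cong (_* Cᶜ v w) (Cᶜ-row-off eu w)) ⟩
            ∑ₗ pts (λ w → (k * δ u w) * Cᶜ v w)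
              ≡⟨ ∑-scaled-δ k u (Cᶜ v) ⟩
            k * Cᶜ v u
              ≡⟨ cong (k *_) (Cᶜ-sym v u) ⟩
            k * Cᶜ u v ∎
          ... | true | false = begin
            ∑ₗ pts (λ w → Cᶜ u w * Cᶜ v w)
              ≡⟨ ∑ₗ-cong pts (λ w → trans (ℕ.*-comm (Cᶜ u w) _) (cong (_* Cᶜ u w) (Cᶜ-row-off ev w))) ⟩
            ∑ₗ pts (λ w → (k * δ v w) * Cᶜ u w)
              ≡⟨ ∑-scaled-δ k v (Cᶜ u) ⟩
            k * Cᶜ u v ∎
          ... | true | true = begin
            ∑ₗ pts (λ w → Cᶜ u w * Cᶜ v w)
              ≡⟨ ∑ₗ-cong pts (λ w → cong₂ _*_ (Cᶜ-row-on eu w) (Cᶜ-row-on ev w)) ⟩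
            ∑ₗ pts (λ w → cliqueᶜ κ u w * cliqueᶜ κ v w)
              ≡⟨ ∑-clique² κ u v eu ev ⟩
            k * cliqueᶜ κ u v
              ≡⟨ cong (k *_) (Cᶜ-row-on eu v) ⟨
            k * Cᶜ u v ∎

        Cᶜ⊙sameBlock : Cᶜ ⊙ sameBlock ≈ᴹ Γ κ
        Cᶜ⊙sameBlock u v with special κ (r u) in eu
        ... | false = begin
          ∑ₗ pts (λ w → Cᶜ u w * sameBlock w v)       ≡⟨ ∑ₗ-cong pts (λ w → cong (_* sameBlock w v) (Cᶜ-row-off eu w)) ⟩
          ∑ₗ pts (λ w → (k * δ u w) * sameBlock w v)  ≡⟨ ∑-scaled-δ k u (λ w → sameBlock w v) ⟩
          k * sameBlock u v                           ≡⟨ Γ-off κ u v eu ⟨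
          Γ κ u v                                     ∎
        ... | true = trans (∑ₗ-cong pts (λ w → cong (_* sameBlock w v) (Cᶜ-row-on eu w))) (∑-clique-sameBlock κ u v eu)

        Cᶜ-commutes-sameBlock : Cᶜ ⊙ sameBlock ≈ᴹ sameBlock ⊙ Cᶜ
        Cᶜ-commutes-sameBlock = symmetric-product⇒commute Cᶜ-sym sameBlock-sym
          (λ u v → trans (Cᶜ⊙sameBlock u v) (trans (Γ-sym κ u v) (sym (Cᶜ⊙sameBlock v u))))

        Cᶜ-commutes-ones : Cᶜ ⊙ ones ≈ᴹ ones ⊙ Cᶜ
        Cᶜ-commutes-ones = symmetric-product⇒commute Cᶜ-sym (λ _ _ → refl) (λ u v → trans (row-k u v) (sym (row-k v u)))
          where
          row-k : ∀ u v → (Cᶜ ⊙ ones) u v ≡ k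
          row-k u _ = trans (∑ₗ-cong pts (λ w → ℕ.*-identityʳ (Cᶜ u w))) (Cᶜ-rowsum u)

        Cᶜ-commutes-adj : ∀ h → Cᶜ ⊙ adj h ≈ᴹ adj h ⊙ Cᶜ
        Cᶜ-commutes-adj 0F = commute-resp (≈ᴹ-sym adj-0F) (δ-commute Cᶜ)
        Cᶜ-commutes-adj 1F = commute-⊕⁻ Cᶜ (adj 0F) (adj 1F) (Cᶜ-commutes-adj 0F)
          (commute-resp (≈ᴹ-sym adj-0F⊕adj-1F) Cᶜ-commutes-sameBlock)
        Cᶜ-commutes-adj 2F = commute-⊕⁻ Cᶜ sameBlock (adj 2F) Cᶜ-commutes-sameBlock
          (commute-resp (≈ᴹ-sym sameBlock⊕adj-2F) Cᶜ-commutes-ones)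

-- The centre of 𝕋

module Centre {c ℓ} (F : Field c ℓ) (n : ℕ) (ℓs ms : Fin n → ℕ) (x : Scheme.X n ℓs ms) where
  open Algebras F n ℓs ms x
  open Field F using (refl; commutativeRing)
  open SquareMatrices (CommutativeRing.commutativeSemiring commutativeRing) (Scheme.allX n ℓs ms)
    using (≈ᴹ-setoid; ≈ᴹ-refl; ≈ᴹ-sym; ≈ᴹ-trans; ⊕-cong; ·-cong; ⊙-cong; ⊙-assoc; ⊙-distribˡ; ⊙-distribʳ;
           ⊙-zeroˡ; ⊙-zeroʳ; ·-⊙-assoc; ⊙-·-comm)
  open import Relation.Binary.Reasoning.Setoid ≈ᴹ-setoid

  commute-generators⇒commute-𝕋 : ∀ {M} → (∀ g → (M ⊗ A g) ≈ᴹ (A g ⊗ M)) → (∀ g → (M ⊗ E* g) ≈ᴹ (E* g ⊗ M)) →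
                                 (M ⊗ I) ≈ᴹ (I ⊗ M) → ∀ {N} → InT N → (M ⊗ N) ≈ᴹ (N ⊗ M)
  commute-generators⇒commute-𝕋 {M} MA≈AM ME≈EM MI≈IM = go
    where
    go : ∀ {N} → InT N → (M ⊗ N) ≈ᴹ (N ⊗ M)
    go (genA g)            = MA≈AM g
    go (genE g)            = ME≈EM g
    go one                 = MI≈IM
    go zer                 = ≈ᴹ-trans (⊙-zeroʳ M) (≈ᴹ-sym (⊙-zeroˡ M))
    go (add {N} {P} N∈ P∈) =
      ≈ᴹ-trans (⊙-distribˡ M N P) (≈ᴹ-trans (⊕-cong (go N∈) (go P∈)) (≈ᴹ-sym (⊙-distribʳ M N P)))
    go (scale s {N} N∈)    = ≈ᴹ-trans (⊙-·-comm s M N) (≈ᴹ-trans (·-cong refl (go N∈)) (≈ᴹ-sym (·-⊙-assoc s N M)))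
    go (resp N≈P N∈)       = ≈ᴹ-trans (⊙-cong ≈ᴹ-refl (≈ᴹ-sym N≈P)) (≈ᴹ-trans (go N∈) (⊙-cong N≈P ≈ᴹ-refl))
    go (mul {N} {P} N∈ P∈) = begin
      M ⊗ (N ⊗ P)  ≈⟨ ⊙-assoc M N P ⟨
      (M ⊗ N) ⊗ P  ≈⟨ ⊙-cong (go N∈) ≈ᴹ-refl ⟩
      (N ⊗ M) ⊗ P  ≈⟨ ⊙-assoc N M P ⟩
      N ⊗ (M ⊗ P)  ≈⟨ ⊙-cong ≈ᴹ-refl (go P∈) ⟩
      N ⊗ (P ⊗ M)  ≈⟨ ⊙-assoc N P M ⟨
      (N ⊗ P) ⊗ M  ∎

  InZ-resp : ∀ {M N} → M ≈ᴹ N → InZ M → InZ N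
  InZ-resp M≈N (M∈ , M-central) = resp M≈N M∈ , λ P P∈ →
    ≈ᴹ-trans (⊙-cong (≈ᴹ-sym M≈N) ≈ᴹ-refl) (≈ᴹ-trans (M-central P P∈) (⊙-cong ≈ᴹ-refl M≈N))

  InZ-O : InZ O
  InZ-O = zer , λ P _ → ≈ᴹ-trans (⊙-zeroˡ P) (≈ᴹ-sym (⊙-zeroʳ P))

  InZ-⊕ : ∀ {M N} → InZ M → InZ N → InZ (M ⊕ N)
  InZ-⊕ {M} {N} (M∈ , M-central) (N∈ , N-central) = add M∈ N∈ , λ P P∈ →
    ≈ᴹ-trans (⊙-distribʳ P M N) (≈ᴹ-trans (⊕-cong (M-central P P∈) (N-central P P∈)) (≈ᴹ-sym (⊙-distribˡ P M N)))

  InZ-· : ∀ s {M} → InZ M → InZ (s · M)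
  InZ-· s {M} (M∈ , M-central) = scale s M∈ , λ P P∈ →
    ≈ᴹ-trans (·-⊙-assoc s M P) (≈ᴹ-trans (·-cong refl (M-central P P∈)) (≈ᴹ-sym (⊙-·-comm s P M)))

  InZ-⊗ : ∀ {M N} → InZ M → InZ N → InZ (M ⊗ N)
  InZ-⊗ {M} {N} (M∈ , M-central) (N∈ , N-central) = mul M∈ N∈ , λ P P∈ → begin
    (M ⊗ N) ⊗ P  ≈⟨ ⊙-assoc M N P ⟩
    M ⊗ (N ⊗ P)  ≈⟨ ⊙-cong ≈ᴹ-refl (N-central P P∈) ⟩
    M ⊗ (P ⊗ N)  ≈⟨ ⊙-assoc M P N ⟨
    (M ⊗ P) ⊗ N  ≈⟨ ⊙-cong (M-central P P∈) ≈ᴹ-refl ⟩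
    (P ⊗ M) ⊗ N  ≈⟨ ⊙-assoc P M N ⟩
    P ⊗ (M ⊗ N)  ∎

  module _ {C} (C-central : InZ C) (C²≈O : (C ⊗ C) ≈ᴹ O) where

    MultipleOfC : Mat → Set (c ⊔ ℓ)
    MultipleOfC M = InZ M × ∃[ N ] M ≈ᴹ (N ⊗ C)

    C-slides : ∀ N {P} → InT P → ((N ⊗ C) ⊗ P) ≈ᴹ ((N ⊗ P) ⊗ C)
    C-slides N {P} P∈ = begin
      (N ⊗ C) ⊗ P  ≈⟨ ⊙-assoc N C P ⟩
      N ⊗ (C ⊗ P)  ≈⟨ ⊙-cong ≈ᴹ-refl (proj₂ C-central P P∈) ⟩
      N ⊗ (P ⊗ C)  ≈⟨ ⊙-assoc N P C ⟨
      (N ⊗ P) ⊗ C  ∎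

    multiples-annihilate : ∀ {M M′} → MultipleOfC M → MultipleOfC M′ → (M ⊗ M′) ≈ᴹ O
    multiples-annihilate {M} {M′} (_ , N , M≈NC) ((M′∈ , _) , N′ , M′≈N′C) = begin
      M ⊗ M′              ≈⟨ ⊙-cong M≈NC ≈ᴹ-refl ⟩
      (N ⊗ C) ⊗ M′        ≈⟨ C-slides N M′∈ ⟩
      (N ⊗ M′) ⊗ C        ≈⟨ ⊙-cong (⊙-cong ≈ᴹ-refl M′≈N′C) ≈ᴹ-refl ⟩
      (N ⊗ (N′ ⊗ C)) ⊗ C  ≈⟨ ⊙-cong (⊙-assoc N N′ C) ≈ᴹ-refl ⟨
      ((N ⊗ N′) ⊗ C) ⊗ C  ≈⟨ ⊙-assoc (N ⊗ N′) C C ⟩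
      (N ⊗ N′) ⊗ (C ⊗ C)  ≈⟨ ⊙-cong ≈ᴹ-refl C²≈O ⟩
      (N ⊗ N′) ⊗ O        ≈⟨ ⊙-zeroʳ (N ⊗ N′) ⟩
      O                   ∎

    multiples-nilpotent-ideal : IsNilpotentIdealOfZ MultipleOfC
    multiples-nilpotent-ideal = record
      { ⊆Z        = proj₁
      ; resp𝓘     = λ { M≈M′ (M∈ , N , M≈NC) → InZ-resp M≈M′ M∈ , N , ≈ᴹ-trans (≈ᴹ-sym M≈M′) M≈NC }
      ; zero𝓘     = InZ-O , O , ≈ᴹ-sym (⊙-zeroˡ C)
      ; add𝓘      = λ { (M∈ , N , M≈NC) (M′∈ , N′ , M′≈N′C) →
                        InZ-⊕ M∈ M′∈ , N ⊕ N′ , ≈ᴹ-trans (⊕-cong M≈NC M′≈N′C) (≈ᴹ-sym (⊙-distribʳ C N N′)) }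
      ; scale𝓘    = λ { s (M∈ , N , M≈NC) →
                        InZ-· s M∈ , s · N , ≈ᴹ-trans (·-cong refl M≈NC) (≈ᴹ-sym (·-⊙-assoc s N C)) }
      ; mulˡ      = λ { {N = P} P∈ (M∈ , N , M≈NC) →
                        InZ-⊗ P∈ M∈ , P ⊗ N , ≈ᴹ-trans (⊙-cong ≈ᴹ-refl M≈NC) (≈ᴹ-sym (⊙-assoc P N C)) }
      ; mulʳ      = λ { {N = P} P∈ (M∈ , N , M≈NC) →
                        InZ-⊗ M∈ P∈ , N ⊗ P , ≈ᴹ-trans (⊙-cong M≈NC ≈ᴹ-refl) (C-slides N (proj₁ P∈)) }
      ; nilpotent = 2 , λ f f∈ → ≈ᴹ-trans (≈ᴹ-sym (⊙-assoc (f zero) (f (suc zero)) I))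
                                  (≈ᴹ-trans (⊙-cong (multiples-annihilate (f∈ zero) (f∈ (suc zero))) ≈ᴹ-refl) (⊙-zeroˡ I))
      }

  central-square-zero⇒zero : ZSemisimple → ∀ {C} → InZ C → (I ⊗ C) ≈ᴹ C → (C ⊗ C) ≈ᴹ O → C ≈ᴹ O
  central-square-zero⇒zero semisimple {C} C-central IC≈C C²≈O =
    semisimple (MultipleOfC C-central C²≈O) (multiples-nilpotent-ideal C-central C²≈O) (C-central , I , ≈ᴹ-sym IC≈C)

-- Factorisation over the coordinates

allFuns-complete : ∀ {a} n (A : Fin n → Set a) (enum : ∀ i → List (A i)) → (∀ i (u : A i) → u ∈ enum i) →
                   (f : ∀ i → A i) → Any (λ g → ∀ i → g i ≡ f i) (allFuns n A enum)
allFuns-complete zero    A enum complete f = here (λ ())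
allFuns-complete (suc n) A enum complete f =
  Any.concatMap⁺ (λ a → map (consF {A = A} a) rest) (Any.map extend (complete zero (f zero)))
  where
  rest : List ((i : Fin n) → A (suc i))
  rest = allFuns n (A ∘ suc) (enum ∘ suc)
  extend : ∀ {a} → f zero ≡ a → Any (λ g → ∀ i → g i ≡ f i) (map (consF {A = A} a) rest)
  extend f₀≡a = Any.map⁺ (Any.map (λ g≗f → λ { zero → ≡.sym f₀≡a ; (suc i) → g≗f i })
                                 (allFuns-complete n (A ∘ suc) (enum ∘ suc) (complete ∘ suc) (f ∘ suc)))

module Tensor {c ℓ} (F : Field c ℓ) (n : ℕ) (ℓs ms : Fin n → ℕ) (x : Scheme.X n ℓs ms) where
  open Scheme n ℓs ms
  open Algebras F n ℓs ms x
  open Field F using (Carrier; _≈_; _+_; _*_; 0#; 1#; commutativeRing)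
  open CommutativeRing commutativeRing using (commutativeSemiring; semiring; refl; sym; trans; reflexive;
    *-cong; +-congˡ; *-congˡ; *-congʳ; +-identityʳ; *-identityˡ; zeroˡ; *-comm; *-assoc)
  open ListSum commutativeSemiring
  open import Algebra.Properties.Semiring.Mult semiring using (×-homo-+; ×1-homo-*) renaming (_×_ to _×ᴿ_)
  open import Relation.Binary.Reasoning.Setoid (CommutativeRing.setoid commutativeRing)
  module ℕΣ = ListSum ℕ.+-*-commutativeSemiring
  open Coordinate using (Kind; kind; kᶜ; Tᶜ)
  module Uⱼ (j : Fin n) = Coordinate.Factor (ℓs j) (ms j) (x j)
  open Centre F n ℓs ms x

  ι≡×1# : ∀ k → ι k ≡ k ×ᴿ 1#
  ι≡×1# zero    = ≡.refl
  ι≡×1# (suc k) = ≡.cong (1# +_) (ι≡×1# k)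

  ι-+ : ∀ a b → ι (a ℕ.+ b) ≈ ι a + ι b
  ι-+ a b = begin
    ι (a ℕ.+ b)        ≡⟨ ι≡×1# (a ℕ.+ b) ⟩
    (a ℕ.+ b) ×ᴿ 1#     ≈⟨ ×-homo-+ 1# a b ⟩
    a ×ᴿ 1# + b ×ᴿ 1#    ≡⟨ ≡.cong₂ _+_ (ι≡×1# a) (ι≡×1# b) ⟨
    ι a + ι b          ∎

  ι-* : ∀ a b → ι (a ℕ.* b) ≈ ι a * ι b
  ι-* a b = begin
    ι (a ℕ.* b)          ≡⟨ ι≡×1# (a ℕ.* b) ⟩
    (a ℕ.* b) ×ᴿ 1#       ≈⟨ ×1-homo-* a b ⟩
    (a ×ᴿ 1#) * (b ×ᴿ 1#)  ≡⟨ ≡.cong₂ _*_ (ι≡×1# a) (ι≡×1# b) ⟨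
    ι a * ι b            ∎

  ι-[_] : ∀ b → ι (ℕΣ.[ b ]) ≈ [ b ]
  ι-[ true ]  = +-identityʳ 1#
  ι-[ false ] = refl

  ι-∑ₗ : ∀ {a} {A : Set a} (xs : List A) (f : A → ℕ) → ι (ℕΣ.∑ₗ xs f) ≈ ∑ₗ xs (λ a → ι (f a))
  ι-∑ₗ []       f = refl
  ι-∑ₗ (y ∷ xs) f = trans (ι-+ (f y) _) (+-congˡ (ι-∑ₗ xs f))

  ι-∏ : ∀ {m} (f : Fin m → ℕ) → ι (ℕΣ.∏ f) ≈ ∏ (λ j → ι (f j))
  ι-∏ {zero}  f = +-identityʳ 1#
  ι-∏ {suc m} f = trans (ι-* (f zero) _) (*-congˡ (ι-∏ (λ j → f (suc j))))

  Factors : Set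
  Factors = (j : Fin n) → U j → U j → ℕ

  δᵇ : X → X → Fin n → Bool
  δᵇ y z j = ⌊ proj₁ (y j) Fin.≟ proj₁ (z j) ⌋ ∧ ⌊ proj₂ (y j) Fin.≟ proj₂ (z j) ⌋

  IsTensor : Factors → Mat → Set ℓ
  IsTensor m M = ∀ y z → M y z ≈ ∏ (λ j → ι (m j (y j) (z j)))

  _⊙ᶠ_ : Factors → Factors → Factors
  (m ⊙ᶠ m′) j = Uⱼ._⊙_ j (m j) (m′ j)

  tensor-⊗ : ∀ {m m′ M N} → IsTensor m M → IsTensor m′ N → IsTensor (m ⊙ᶠ m′) (M ⊗ N)
  tensor-⊗ {m} {m′} {M} {N} M≈ N≈ y z = begin
    ∑ₗ allX (λ w → M y w * N w z)
      ≈⟨ ∑ₗ-cong allX (λ w → trans (*-cong (M≈ y w) (N≈ w z)) (sym (∏-distrib-* (mʸ w) (m′ᶻ w)))) ⟩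
    ∑ₗ allX (λ w → ∏ (λ j → ι (m j (y j) (w j)) * ι (m′ j (w j) (z j))))
      ≈⟨ ∑ₗ-allFuns n U Uⱼ.pts (λ j u → ι (m j (y j) u) * ι (m′ j u (z j))) ⟩
    ∏ (λ j → ∑ₗ (Uⱼ.pts j) (λ u → ι (m j (y j) u) * ι (m′ j u (z j))))
      ≈⟨ ∏-cong (λ j → sym (trans (ι-∑ₗ (Uⱼ.pts j) _) (∑ₗ-cong (Uⱼ.pts j) (λ u → ι-* (m j (y j) u) _)))) ⟩
    ∏ (λ j → ι ((m ⊙ᶠ m′) j (y j) (z j))) ∎
    where
    mʸ m′ᶻ : X → Fin n → Carrier
    mʸ w j = ι (m j (y j) (w j))
    m′ᶻ w j = ι (m′ j (w j) (z j))

  tensor-resp : ∀ {m m′ M} → (∀ j → Uⱼ._≈ᴹ_ j (m j) (m′ j)) → IsTensor m M → IsTensor m′ M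
  tensor-resp m≈m′ M≈ y z = trans (M≈ y z) (∏-cong (λ j → reflexive (≡.cong ι (m≈m′ j (y j) (z j)))))

  tensor-unique : ∀ {m M N} → IsTensor m M → IsTensor m N → M ≈ᴹ N
  tensor-unique M≈ N≈ y z = trans (M≈ y z) (sym (N≈ y z))

  tensor-commute : ∀ {m m′ M N} → IsTensor m M → IsTensor m′ N →
                   (∀ j → Uⱼ._≈ᴹ_ j ((m ⊙ᶠ m′) j) ((m′ ⊙ᶠ m) j)) → (M ⊗ N) ≈ᴹ (N ⊗ M)
  tensor-commute {m} {m′} M≈ N≈ mm′≈m′m =
    tensor-unique {m′ ⊙ᶠ m} (tensor-resp {m ⊙ᶠ m′} mm′≈m′m (tensor-⊗ {m} {m′} M≈ N≈)) (tensor-⊗ {m′} {m} N≈ M≈)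

  I-tensor : IsTensor Uⱼ.δ I
  I-tensor y z = trans ([all] (δᵇ y z)) (∏-cong (λ j → sym ι-[ δᵇ y z j ]))

  A-factors E*-factors : E → Factors
  A-factors h j = Uⱼ.adj j (h j)
  E*-factors h j = Uⱼ.E*ᶜ j (h j)

  A-tensor : ∀ h → IsTensor (A-factors h) (A h)
  A-tensor h y z = trans ([all] relᵇ) (∏-cong (λ j → sym ι-[ relᵇ j ]))
    where
    relᵇ : Fin n → Bool
    relᵇ j = ⌊ rel y z j Fin.≟ h j ⌋

  E*-tensor : ∀ h → IsTensor (E*-factors h) (E* h)
  E*-tensor h y z = begin
    [ eqE (rel x y) h ∧ eqX y z ]                         ≈⟨ [∧] (eqE (rel x y) h) (eqX y z) ⟩
    [ eqE (rel x y) h ] * [ eqX y z ]                     ≈⟨ *-cong ([all] relᵇ) ([all] (δᵇ y z)) ⟩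
    ∏ (λ j → [ relᵇ j ]) * ∏ (λ j → [ δᵇ y z j ])         ≈⟨ ∏-distrib-* (λ j → [ relᵇ j ]) (λ j → [ δᵇ y z j ]) ⟨
    ∏ (λ j → [ relᵇ j ] * [ δᵇ y z j ])
      ≈⟨ ∏-cong (λ j → sym (trans (ι-* ℕΣ.[ relᵇ j ] ℕΣ.[ δᵇ y z j ]) (*-cong ι-[ relᵇ j ] ι-[ δᵇ y z j ]))) ⟩
    ∏ (λ j → ι (Uⱼ.E*ᶜ j (h j) (y j) (z j)))           ∎
    where
    relᵇ : Fin n → Bool
    relᵇ j = ⌊ rel x y j Fin.≟ h j ⌋

  ι-k : ∀ t → ι (k t) ≈ ∏ (λ j → ι (kᶜ (J₁ t j) (J₂ t j) (J₃ t j) (ℓs j) (ms j)))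
  ι-k t = begin
    ι (prodℕ f₁ ℕ.* (prodℕ f₂ ℕ.* prodℕ f₃))
      ≈⟨ trans (ι-* (prodℕ f₁) _) (*-congˡ (ι-* (prodℕ f₂) _)) ⟩
    ι (prodℕ f₁) * (ι (prodℕ f₂) * ι (prodℕ f₃))
      ≈⟨ *-cong (ι-prodℕ f₁) (*-cong (ι-prodℕ f₂) (ι-prodℕ f₃)) ⟩
    ∏ (ι ∘ f₁) * (∏ (ι ∘ f₂) * ∏ (ι ∘ f₃))
      ≈⟨ trans (*-congˡ (sym (∏-distrib-* (ι ∘ f₂) (ι ∘ f₃)))) (sym (∏-distrib-* (ι ∘ f₁) _)) ⟩
    ∏ (λ j → ι (f₁ j) * (ι (f₂ j) * ι (f₃ j)))
      ≈⟨ ∏-cong (λ j → sym (trans (ι-* (f₁ j) _) (*-congˡ (ι-* (f₂ j) (f₃ j))))) ⟩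
    ∏ (λ j → ι (kᶜ (J₁ t j) (J₂ t j) (J₃ t j) (ℓs j) (ms j))) ∎
    where
    f₁ f₂ f₃ : Fin n → ℕ
    f₁ j = if J₁ t j then ms j ℕ.∸ 1 else 1
    f₂ j = if J₂ t j then (ℓs j ℕ.∸ 1) ℕ.* ms j else 1
    f₃ j = if J₃ t j ∧ not (J₂ t j) then ms j else 1
    ι-prodℕ : ∀ f → ι (prodℕ f) ≈ ∏ (ι ∘ f)
    ι-prodℕ f = trans (reflexive (≡.cong ι (ℕΣ.∏-tabulate id f))) (ι-∏ f)

  pts-complete : ∀ j (u : U j) → u ∈ Uⱼ.pts j
  pts-complete j (b , p) = ∈-cartesianProduct⁺ (∈-allFin b) (∈-allFin p)

  eqE-cong : ∀ {e e′ : E} g → (∀ i → e i ≡ e′ i) → eqE e g ≡ eqE e′ g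
  eqE-cong g e≗e′ = ≡.cong and (map-cong (λ i → ≡.cong (λ t → ⌊ t Fin.≟ g i ⌋) (e≗e′ i)) (allFin n))

  nonzeroᵇ-intro : ∀ g a h y z → T (eqE (rel x y) g) → T (eqE (rel y z) a) → T (eqE (rel x z) h) → T (nonzeroᵇ g a h)
  nonzeroᵇ-intro g a h y z xy yz xz =
    Any.any⁺ _ (Any.map (λ {y′} y′≗y → Any.any⁺ _ (Any.map (λ {z′} z′≗z → witness y′ z′ y′≗y z′≗z) (in-allX z)))
                        (in-allX y))
    where
    in-allX : ∀ w → Any (λ w′ → ∀ i → w′ i ≡ w i) allX
    in-allX = allFuns-complete n U Uⱼ.pts pts-complete
    transport : ∀ {e e′} g → (∀ i → e′ i ≡ e i) → T (eqE e g) → T (eqE e′ g)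
    transport g e′≗e = ≡.subst T (≡.sym (eqE-cong g e′≗e))
    witness : ∀ y′ z′ → (∀ i → y′ i ≡ y i) → (∀ i → z′ i ≡ z i) →
              T (eqE (rel x y′) g ∧ (eqE (rel y′ z′) a ∧ eqE (rel x z′) h))
    witness y′ z′ y′≗y z′≗z = Equivalence.from T-∧ (transport g (λ i → ≡.cong (relU (x i)) (y′≗y i)) xy ,
      Equivalence.from T-∧ (transport a (λ i → ≡.cong₂ relU (y′≗y i) (z′≗z i)) yz ,
                            transport h (λ i → ≡.cong (relU (x i)) (z′≗z i)) xz))

  module Cⱼ (τ : Triple) (j : Fin n) = Uⱼ.CFactor j (J₁ τ j) (J₂ τ j) (J₃ τ j) (2 <ᵇ ℓs j) (2 <ᵇ ms j) ≡.refl ≡.refl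

  E*AE* : E → E → Mat
  E*AE* i a = (E* i ⊗ A a) ⊗ E* i

  E*AE*-tensor : ∀ i a → IsTensor (λ j u v → Tᶜ (i j) (a j) (Uⱼ.r j u) (Uⱼ.rel j u v) (Uⱼ.r j v)) (E*AE* i a)
  E*AE*-tensor i a = tensor-resp {(E*-factors i ⊙ᶠ A-factors a) ⊙ᶠ E*-factors i} (λ j → Uⱼ.E*ᶜ⊙adj⊙E*ᶜ j (i j) (a j))
    (tensor-⊗ {E*-factors i ⊙ᶠ A-factors a} {E*-factors i}
      (tensor-⊗ {E*-factors i} {A-factors a} (E*-tensor i) (A-tensor a)) (E*-tensor i))

  E*AE*-indicator : ∀ i a y z → E*AE* i a y z ≈ [ eqE (rel x y) i ∧ (eqE (rel y z) a ∧ eqE (rel x z) i) ]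
  E*AE*-indicator i a y z = begin
    E*AE* i a y z
      ≈⟨ E*AE*-tensor i a y z ⟩
    ∏ (λ j → ι (ℕΣ.[ b₁ j ] ℕ.* (ℕΣ.[ b₂ j ] ℕ.* ℕΣ.[ b₃ j ])))
      ≈⟨ ∏-cong (λ j → trans (ι-* ℕΣ.[ b₁ j ] _)
                          (*-cong ι-[ b₁ j ] (trans (ι-* ℕΣ.[ b₂ j ] _) (*-cong ι-[ b₂ j ] ι-[ b₃ j ])))) ⟩
    ∏ (λ j → [ b₁ j ] * ([ b₂ j ] * [ b₃ j ]))
      ≈⟨ trans (∏-distrib-* (λ j → [ b₁ j ]) _) (*-congˡ (∏-distrib-* (λ j → [ b₂ j ]) _)) ⟩
    ∏ (λ j → [ b₁ j ]) * (∏ (λ j → [ b₂ j ]) * ∏ (λ j → [ b₃ j ]))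
      ≈⟨ *-cong ([all] b₁) (*-cong ([all] b₂) ([all] b₃)) ⟨
    [ eqE (rel x y) i ] * ([ eqE (rel y z) a ] * [ eqE (rel x z) i ])
      ≈⟨ trans ([∧] (eqE (rel x y) i) _) (*-congˡ ([∧] (eqE (rel y z) a) (eqE (rel x z) i))) ⟨
    [ eqE (rel x y) i ∧ (eqE (rel y z) a ∧ eqE (rel x z) i) ] ∎
    where
    b₁ b₂ b₃ : Fin n → Bool
    b₁ j = ⌊ rel x y j Fin.≟ i j ⌋
    b₂ j = ⌊ rel y z j Fin.≟ a j ⌋
    b₃ j = ⌊ rel x z j Fin.≟ i j ⌋

  nonzeroᵇ-absorbs : ∀ i a y z → [ nonzeroᵇ i a i ] * E*AE* i a y z ≈ E*AE* i a y z
  nonzeroᵇ-absorbs i a y z =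
    trans (*-congˡ (E*AE*-indicator i a y z)) (trans (absorb _ _ nonzero) (sym (E*AE*-indicator i a y z)))
    where
    nonzero : T (eqE (rel x y) i ∧ (eqE (rel y z) a ∧ eqE (rel x z) i)) → T (nonzeroᵇ i a i)
    nonzero t = let (xy , t′) = Equivalence.to T-∧ t ; (yz , xz) = Equivalence.to T-∧ t′ in nonzeroᵇ-intro i a i y z xy yz xz
    absorb : ∀ b e → (T e → T b) → [ b ] * [ e ] ≈ [ e ]
    absorb true  e     _   = *-identityˡ [ e ]
    absorb false false _   = zeroˡ 0#
    absorb false true  e⇒b = ⊥-elim (e⇒b tt)

  -- The filter of B i i (i ⋂ τ) is nonzeroᵇ i a i ∧ admissible τ i a.
  admissible : Triple → E → E → Bool
  admissible τ i a = ((S₁ a ∩ ((S₁ i ∩ S₁ i) ∘)) ⊆ᵇ (S₁ i ∩ J₁ τ))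
                   ∧ (((S₂ a ∩ ((S₂ i ∩ S₂ i) •)) ⊆ᵇ (S₂ i ∩ J₂ τ))
                      ∧ ((S₁ a ∩ (S₂ i ∩ S₂ i)) ⊆ᵇ (S₂ i ∩ J₃ τ)))

  [admissible] : ∀ τ i a → [ admissible τ i a ] ≈ ∏ (λ j → [ Cⱼ.allowed τ j (i j) (a j) ])
  [admissible] τ i a = begin
    [ admissible τ i a ]
      ≈⟨ trans ([∧] (all p₁ (allFin n)) _) (*-congˡ ([∧] (all p₂ (allFin n)) _)) ⟩
    [ all p₁ (allFin n) ] * ([ all p₂ (allFin n) ] * [ all p₃ (allFin n) ])
      ≈⟨ *-cong ([all] p₁) (*-cong ([all] p₂) ([all] p₃)) ⟩
    ∏ (λ j → [ p₁ j ]) * (∏ (λ j → [ p₂ j ]) * ∏ (λ j → [ p₃ j ]))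
      ≈⟨ trans (∏-distrib-* (λ j → [ p₁ j ]) (λ j → [ p₂ j ] * [ p₃ j ]))
               (*-congˡ (∏-distrib-* (λ j → [ p₂ j ]) (λ j → [ p₃ j ]))) ⟨
    ∏ (λ j → [ p₁ j ] * ([ p₂ j ] * [ p₃ j ]))
      ≈⟨ ∏-cong (λ j → trans ([∧] (p₁ j) _) (*-congˡ ([∧] (p₂ j) (p₃ j)))) ⟨
    ∏ (λ j → [ Cⱼ.allowed τ j (i j) (a j) ]) ∎
    where
    p₁ p₂ p₃ : Fin n → Bool
    p₁ j = not ((S₁ a ∩ ((S₁ i ∩ S₁ i) ∘)) j) ∨ (S₁ i ∩ J₁ τ) j
    p₂ j = not ((S₂ a ∩ ((S₂ i ∩ S₂ i) •)) j) ∨ (S₂ i ∩ J₂ τ) j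
    p₃ j = not ((S₁ a ∩ (S₂ i ∩ S₂ i)) j) ∨ (S₂ i ∩ J₃ τ) j

  ΣM-entry : ∀ {a} {A : Set a} (xs : List A) (f : A → Mat) y z → ΣM xs f y z ≡ ∑ₗ xs (λ i → f i y z)
  ΣM-entry []       f y z = ≡.refl
  ΣM-entry (i ∷ xs) f y z = ≡.cong (f i y z +_) (ΣM-entry xs f y z)

  B-factor : Triple → (j : Fin n) → Fin 3 → U j → U j → ℕ
  B-factor τ j i′ u v =
    ℕΣ.∑ₗ (allFin 3) (λ a′ → ℕΣ.[ Cⱼ.allowed τ j i′ a′ ] ℕ.* Tᶜ i′ a′ (Uⱼ.r j u) (Uⱼ.rel j u v) (Uⱼ.r j v))

  B-tensor : ∀ τ i → IsTensor (λ j → B-factor τ j (i j)) (B i i (i ⋂ τ))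
  B-tensor τ i y z = begin
    B i i (i ⋂ τ) y z
      ≡⟨ ΣM-entry (filterᵇ condition allE) (E*AE* i) y z ⟩
    ∑ₗ (filterᵇ condition allE) (λ a → E*AE* i a y z)
      ≈⟨ ∑ₗ-filterᵇ condition allE (λ a → E*AE* i a y z) ⟩
    ∑ₗ allE (λ a → [ condition a ] * E*AE* i a y z)
      ≈⟨ ∑ₗ-cong allE term ⟩
    ∑ₗ allE (λ a → ∏ (λ j → ι (entry j (a j))))
      ≈⟨ ∑ₗ-allFuns n (λ _ → Fin 3) (λ _ → allFin 3) (λ j a′ → ι (entry j a′)) ⟩
    ∏ (λ j → ∑ₗ (allFin 3) (λ a′ → ι (entry j a′)))
      ≈⟨ ∏-cong (λ j → sym (ι-∑ₗ (allFin 3) (entry j))) ⟩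
    ∏ (λ j → ι (B-factor τ j (i j) (y j) (z j))) ∎
    where
    condition : E → Bool
    condition a = nonzeroᵇ i a i ∧ admissible τ i a
    allowed-at : Fin n → Fin 3 → Bool
    allowed-at j = Cⱼ.allowed τ j (i j)
    T-at : Fin n → Fin 3 → ℕ
    T-at j a′ = Tᶜ (i j) a′ (Uⱼ.r j (y j)) (Uⱼ.rel j (y j) (z j)) (Uⱼ.r j (z j))
    entry : Fin n → Fin 3 → ℕ
    entry j a′ = ℕΣ.[ allowed-at j a′ ] ℕ.* T-at j a′
    term : ∀ a → [ condition a ] * E*AE* i a y z ≈ ∏ (λ j → ι (entry j (a j)))
    term a = begin
      [ condition a ] * E*AE* i a y z
        ≈⟨ trans (*-congʳ ([∧] (nonzeroᵇ i a i) _)) (trans (*-congʳ (*-comm _ _)) (*-assoc _ _ _)) ⟩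
      [ admissible τ i a ] * ([ nonzeroᵇ i a i ] * E*AE* i a y z)
        ≈⟨ *-cong ([admissible] τ i a) (trans (nonzeroᵇ-absorbs i a y z) (E*AE*-tensor i a y z)) ⟩
      ∏ (λ j → [ allowed-at j (a j) ]) * ∏ (λ j → ι (T-at j (a j)))
        ≈⟨ ∏-distrib-* (λ j → [ allowed-at j (a j) ]) (λ j → ι (T-at j (a j))) ⟨
      ∏ (λ j → [ allowed-at j (a j) ] * ι (T-at j (a j)))
        ≈⟨ ∏-cong (λ j → sym (trans (ι-* ℕΣ.[ allowed-at j (a j) ] _) (*-congʳ ι-[ allowed-at j (a j) ]))) ⟩
      ∏ (λ j → ι (entry j (a j))) ∎

  C-tensor : ∀ τ → IsTensor (Cⱼ.Cᶜ τ) (C τ)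
  C-tensor τ y z = begin
    C τ y z
      ≡⟨ ΣM-entry allE (λ i → ι (k (τ ∖ i)) · B i i (i ⋂ τ)) y z ⟩
    ∑ₗ allE (λ i → ι (k (τ ∖ i)) * B i i (i ⋂ τ) y z)
      ≈⟨ ∑ₗ-cong allE factorise ⟩
    ∑ₗ allE (λ i → ∏ (λ j → ι (term j (i j))))
      ≈⟨ ∑ₗ-allFuns n (λ _ → Fin 3) (λ _ → allFin 3) (λ j i′ → ι (term j i′)) ⟩
    ∏ (λ j → ∑ₗ (allFin 3) (λ i′ → ι (term j i′)))
      ≈⟨ ∏-cong (λ j → trans (sym (ι-∑ₗ (allFin 3) (term j))) (reflexive (≡.cong ι (collapse j)))) ⟩
    ∏ (λ j → ι (Cⱼ.Cᶜ τ j (y j) (z j))) ∎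
    where
    term : (j : Fin n) → Fin 3 → ℕ
    term j i′ = Cⱼ.k∖ τ j i′ ℕ.* B-factor τ j i′ (y j) (z j)
    collapse : ∀ j → ℕΣ.∑ₗ (allFin 3) (term j) ≡ Cⱼ.Cᶜ τ j (y j) (z j)
    collapse j = Cⱼ.Φ-collapse τ j (Uⱼ.r j (y j)) (Uⱼ.rel j (y j) (z j)) (Uⱼ.r j (z j))
    factorise : ∀ i → ι (k (τ ∖ i)) * B i i (i ⋂ τ) y z ≈ ∏ (λ j → ι (term j (i j)))
    factorise i = begin
      ι (k (τ ∖ i)) * B i i (i ⋂ τ) y z
        ≈⟨ *-cong (ι-k (τ ∖ i)) (B-tensor τ i y z) ⟩
      ∏ (λ j → ι (Cⱼ.k∖ τ j (i j))) * ∏ (λ j → ι (B-factor τ j (i j) (y j) (z j)))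
        ≈⟨ ∏-distrib-* (λ j → ι (Cⱼ.k∖ τ j (i j))) (λ j → ι (B-factor τ j (i j) (y j) (z j))) ⟨
      ∏ (λ j → ι (Cⱼ.k∖ τ j (i j)) * ι (B-factor τ j (i j) (y j) (z j)))
        ≈⟨ ∏-cong (λ j → sym (ι-* (Cⱼ.k∖ τ j (i j)) _)) ⟩
      ∏ (λ j → ι (term j (i j))) ∎

  C∈𝕋 : ∀ τ → InT (C τ)
  C∈𝕋 τ = ΣM∈𝕋 allE (λ i → scale _ (ΣM∈𝕋 (filterᵇ _ allE) (λ a → mul (mul (genE i) (genA a)) (genE i))))
    where
    ΣM∈𝕋 : ∀ {a} {A : Set a} (xs : List A) {f : A → Mat} → (∀ i → InT (f i)) → InT (ΣM xs f)
    ΣM∈𝕋 []       f∈ = zer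
    ΣM∈𝕋 (i ∷ xs) f∈ = add (f∈ i) (ΣM∈𝕋 xs f∈)

  I⊗C≈C : ∀ τ → (I ⊗ C τ) ≈ᴹ C τ
  I⊗C≈C τ = tensor-unique {Cⱼ.Cᶜ τ} (tensor-resp {Uⱼ.δ ⊙ᶠ Cⱼ.Cᶜ τ} (λ j → Uⱼ.δ-⊙ j (Cⱼ.Cᶜ τ j))
                                          (tensor-⊗ {Uⱼ.δ} {Cⱼ.Cᶜ τ} I-tensor (C-tensor τ))) (C-tensor τ)

  module _ {g : E} {τ : Triple} (τ∈𝒰 : τ ∈𝒰[ g , g ]) where
    open _∈𝒰[_,_] τ∈𝒰

    κ : ∀ j → Kind (g j) (J₁ τ j) (J₂ τ j) (J₃ τ j) (2 <ᵇ ℓs j) (2 <ᵇ ms j)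
    κ j = kind (g j) (J₁ τ j) (J₂ τ j) (J₃ τ j) (2 <ᵇ ℓs j) (2 <ᵇ ms j) (J₁⊆ j) (J₂⊆ j) (J₂⊆J₃ j) (J₃⊆ j)

    C-square : (C τ ⊗ C τ) ≈ᴹ (ι (k τ) · C τ)
    C-square y z = begin
      (C τ ⊗ C τ) y z
        ≈⟨ tensor-⊗ {Cⱼ.Cᶜ τ} {Cⱼ.Cᶜ τ} (C-tensor τ) (C-tensor τ) y z ⟩
      ∏ (λ j → ι (Uⱼ._⊙_ j (Cⱼ.Cᶜ τ j) (Cⱼ.Cᶜ τ j) (y j) (z j)))
        ≈⟨ ∏-cong (λ j → trans (reflexive (≡.cong ι (Cⱼ.Cᶜ-square τ j (κ j) (y j) (z j)))) (ι-* (Cⱼ.k τ j) _)) ⟩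
      ∏ (λ j → ι (Cⱼ.k τ j) * ι (Cⱼ.Cᶜ τ j (y j) (z j)))
        ≈⟨ ∏-distrib-* (λ j → ι (Cⱼ.k τ j)) (λ j → ι (Cⱼ.Cᶜ τ j (y j) (z j))) ⟩
      ∏ (λ j → ι (Cⱼ.k τ j)) * ∏ (λ j → ι (Cⱼ.Cᶜ τ j (y j) (z j)))
        ≈⟨ *-cong (ι-k τ) (C-tensor τ y z) ⟨
      ι (k τ) * C τ y z ∎

    C-central : InZ (C τ)
    C-central = C∈𝕋 τ , λ N N∈ → commute-generators⇒commute-𝕋
      (λ h → tensor-commute {Cⱼ.Cᶜ τ} {A-factors h} (C-tensor τ) (A-tensor h) (λ j → Cⱼ.Cᶜ-commutes-adj τ j (κ j) (h j)))
      (λ h → tensor-commute {Cⱼ.Cᶜ τ} {E*-factors h} (C-tensor τ) (E*-tensor h) (λ j → Cⱼ.Cᶜ-commutes-E* τ j (h j)))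
      (tensor-commute {Cⱼ.Cᶜ τ} {Uⱼ.δ} (C-tensor τ) I-tensor (λ j → Uⱼ.δ-commute j (Cⱼ.Cᶜ τ j)))
      N∈

    C-diagonal : (2≤ℓ : ∀ j → 2 ℕ.≤ ℓs j) (2≤m : ∀ j → 2 ℕ.≤ ms j) →
                 C τ (λ j → Uⱼ.point j (2≤ℓ j) (2≤m j) (g j)) (λ j → Uⱼ.point j (2≤ℓ j) (2≤m j) (g j)) ≈ 1#
    C-diagonal 2≤ℓ 2≤m = trans (C-tensor τ y y) (trans (∏-cong diag) (∏-replicate-1# n))
      where
      y : X
      y j = Uⱼ.point j (2≤ℓ j) (2≤m j) (g j)
      diag : ∀ j → ι (Cⱼ.Cᶜ τ j (y j) (y j)) ≈ 1#
      diag j = trans (reflexive (≡.cong ι (Cⱼ.Cᶜ-diag τ j (κ j) (y j) (Uⱼ.r-point j (2≤ℓ j) (2≤m j) (g j))))) (+-identityʳ 1#)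

lemma4p13 : ∀ {c ℓ : Level} (F : Field c ℓ) (n : ℕ) (ℓs ms : Fin n → ℕ) →
    (∀ i → 2 ≤ ℓs i) → (∀ i → 2 ≤ ms i) →
    (x : Scheme.X n ℓs ms) →
    ((g : Scheme.E n ℓs ms) (τ : Scheme.Triple n ℓs ms) →
       Scheme._∈𝒰[_,_] n ℓs ms τ g g →
       Algebras._≈ᴹ_ F n ℓs ms x
         (Algebras._⊗_ F n ℓs ms x (Algebras.C F n ℓs ms x τ) (Algebras.C F n ℓs ms x τ))
         (Algebras._·_ F n ℓs ms x (Algebras.ι F n ℓs ms x (Scheme.k n ℓs ms τ)) (Algebras.C F n ℓs ms x τ)))
    ×
    (Algebras.ZSemisimple F n ℓs ms x →
       (i : Scheme.E n ℓs ms) (σ : Scheme.Triple n ℓs ms) →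
       Scheme._∈𝒰[_,_] n ℓs ms σ i i →
       ¬ (Field._≈_ F (Algebras.ι F n ℓs ms x (Scheme.k n ℓs ms σ)) (Field.0# F)))
lemma4p13 F n ℓs ms 2≤ℓ 2≤m x = (λ _ _ → C-square) , k≉0
  where
  open Tensor F n ℓs ms x
  open Algebras F n ℓs ms x using (C; ι; ZSemisimple; _≈ᴹ_; _⊗_; O)
  open Scheme n ℓs ms using (E; Triple; k; _∈𝒰[_,_])
  open Field F using (_≈_; 0#; 1≉0; sym; trans; *-congʳ; zeroˡ)
  open Centre F n ℓs ms x using (central-square-zero⇒zero)
  k≉0 : ZSemisimple → (i : E) (σ : Triple) → σ ∈𝒰[ i , i ] → ¬ (ι (k σ) ≈ 0#)
  k≉0 semisimple i σ σ∈𝒰 kσ≈0 = 1≉0 (trans (sym (C-diagonal σ∈𝒰 2≤ℓ 2≤m)) (C≈O _ _))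
    where
    C²≈O : (C σ ⊗ C σ) ≈ᴹ O
    C²≈O a b = trans (C-square σ∈𝒰 a b) (trans (*-congʳ kσ≈0) (zeroˡ _))
    C≈O : C σ ≈ᴹ O
    C≈O = central-square-zero⇒zero semisimple (C-central σ∈𝒰) (I⊗C≈C σ) C²≈O
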